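{- Let $f(x)=\sum_{n\ge0}a(n)x^n\in\mathcal{L}$. Then there exist a nonzero polynomial $Q(x)\in\mathbb{Z}[x]$ and a natural number $m$, both independent of $p$, such that for every prime $p$, setting $A(x):=\sum_{n=0}^{p-1}a(n)x^n$, every non-constant irreducible factor $C(x)\in\mathbb{F}_p[x]$ of $A_{\vert p}(x)$ satisfies: either $C^m$ does not divide $A_{\vert p}$, or $C$ divides $Q_{\vert p}$.
   Context: A sequence $a:\mathbb{N}\to\mathbb{Z}$ has the Lucas property if for every prime $p$, every $n\ge0$ and every $0\le j\le p-1$, $a(pn+j)\equiv a(n)a(j)\pmod p$. $\mathcal{L}$ denotes the set of power series $\sum a(n)x^n\in\mathbb{Z}[[x]]$ with $a(0)=1$, whose coefficient sequence has the Lucas property, and which satisfy a nonzero homogeneous linear differential equation with coefficients in $\mathbb{Q}(x)$. For a polynomial $B\in\mathbb{Z}[x]$, $B_{\vert p}\in\mathbb{F}_p[x]$ is its reduction modulo $p$. -}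

module Defs where

open import Data.Nat using (ℕ; zero; suc; _<_; _≤_)
open import Data.Nat.Primality using (Prime)
open import Data.Integer using (ℤ; +_; _+_; _-_; _*_; 0ℤ; 1ℤ)
open import Data.Integer.Divisibility using (_∣_)
open import Data.List using (List; []; _∷_; map; upTo)
open import Data.List.Relation.Unary.Any using (Any)
open import Data.Product using (_×_; ∃)
open import Data.Sum using (_⊎_)
open import Relation.Nullary using (¬_)
open import Relation.Binary.PropositionalEquality using (_≡_)

Series : Set
Series = ℕ → ℤ

-- Polynomials over ℤ: coefficient lists, lowest degree first.
Poly : Set
Poly = List ℤ

coeff : Poly → ℕ → ℤ
coeff []       _       = 0ℤ
coeff (c ∷ cs) zero    = c
coeff (c ∷ cs) (suc n) = coeff cs n

NonzeroPoly : Poly → Set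
NonzeroPoly P = Any (λ c → ¬ (c ≡ 0ℤ)) P

deriv : Series → Series
deriv f n = (+ suc n) * f (suc n)

mulPS : Poly → Series → Series
mulPS []       f n       = 0ℤ
mulPS (c ∷ cs) f zero    = c * f zero
mulPS (c ∷ cs) f (suc n) = c * f (suc n) + mulPS cs f n

zeroS : Series
zeroS _ = 0ℤ

addS : Series → Series → Series
addS f g n = f n + g n

-- Differential operator  P₀ + P₁ ∂ + … + P_r ∂^r  applied to a series.
applyOp : List Poly → Series → Series
applyOp []       f = zeroS
applyOp (P ∷ Ps) f = addS (mulPS P f) (applyOp Ps (deriv f))

-- f satisfies a nonzero homogeneous linear ODE with coefficients in ℚ(x)
-- (denominators cleared, so coefficients in ℤ[x]).
DFinite : Series → Set
DFinite a = ∃ λ (L : List Poly) → Any NonzeroPoly L × (∀ n → applyOp L a n ≡ 0ℤ)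

Lucas : Series → Set
Lucas a = ∀ (p : ℕ) → Prime p → ∀ (n j : ℕ) → j < p →
  (+ p) ∣ (a ((p Data.Nat.* n) Data.Nat.+ j) - a n * a j)

InL : Series → Set
InL a = (a 0 ≡ 1ℤ) × Lucas a × DFinite a

addP : Poly → Poly → Poly
addP []       q        = q
addP (c ∷ cs) []       = c ∷ cs
addP (c ∷ cs) (d ∷ ds) = (c + d) ∷ addP cs ds

mulP : Poly → Poly → Poly
mulP []       q = []
mulP (c ∷ cs) q = addP (map (c *_) q) (0ℤ ∷ mulP cs q)

powP : Poly → ℕ → Poly
powP C zero    = 1ℤ ∷ []
powP C (suc m) = mulP C (powP C m)

EqMod : ℕ → Poly → Poly → Set
EqMod p A B = ∀ n → (+ p) ∣ (coeff A n - coeff B n)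

DividesMod : ℕ → Poly → Poly → Set
DividesMod p C A = ∃ λ (D : Poly) → EqMod p A (mulP C D)

ConstMod : ℕ → Poly → Set
ConstMod p C = ∀ n → 1 ≤ n → (+ p) ∣ coeff C n

UnitMod : ℕ → Poly → Set
UnitMod p C = ConstMod p C × ¬ ((+ p) ∣ coeff C 0)

IrreducibleMod : ℕ → Poly → Set
IrreducibleMod p C = ¬ ConstMod p C ×
  (∀ (D E : Poly) → EqMod p C (mulP D E) → UnitMod p D ⊎ UnitMod p E)

truncP : Series → ℕ → Poly
truncP a p = map a (upTo p)

-- Fix a prime p and let A be the truncation of f below xᵖ. The Lucas property says
-- f ≡ A(x)·f(xᵖ) (mod p), and f(xᵖ) has zero derivative mod p, so an operator
-- L = P₀ + P₁∂ + … + Pᵣ∂ʳ annihilating f annihilates A modulo p. Take Q = Pᵣ, the last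
-- nonzero coefficient, and m = r. Let C be irreducible mod p with Cᵐ | A, and write A = Cᵏ B
-- with C ∤ B. Since deg A < p, both deg C and k are below p; hence C ∤ C′, and each derivative
-- lowers the C-adic order by exactly one, multiplying the leading coefficient by a unit
-- times C′. So L(A) ≡ Cᵏ⁻ʳ·Pᵣ·u·C′ʳ·B modulo Cᵏ⁻ʳ⁺¹, and L(A) ≡ 0 forces C | Pᵣ.

module Submission where

open import Defs
open import Data.Nat as ℕ using (ℕ; zero; suc; _≤_; _<_; s≤s; z≤n; _∸_)
import Data.Nat.Properties as ℕP
open import Data.Nat.Primality using (Prime)
open import Data.Integer as ℤ using (ℤ; +_; _+_; _-_; _*_; -_; 0ℤ; 1ℤ)
import Data.Integer.Properties as ℤP
open import Data.Integer.Tactic.RingSolver using (solve-∀)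
open import Data.List using (List; []; _∷_; map; length; _++_; applyUpTo)
open import Data.Product using (∃; ∃₂; _×_; _,_; proj₁; proj₂)
open import Data.Sum using (_⊎_; inj₁; inj₂; [_,_]′)
open import Data.Empty using (⊥-elim)
open import Function using (_∘_; id)
open import Data.Nat.DivMod using (_%_; _/_; m≡m%n+[m/n]*n; [m+kn]%n≡m%n; m<n⇒m%n≡m; m*n%n≡0; m*n/n≡m; m%n<n; m%n≤m)
open import Relation.Nullary using (¬_; ¬?; Dec; yes; no)
open import Relation.Nullary.Decidable using (toSum)
open import Relation.Binary.PropositionalEquality

-- Power series over ℤ

infixl 6 _⊕_
infixl 7 _⊛_ _·_

_⊕_ : Series → Series → Series
(a ⊕ b) n = a n + b n

⊝_ : Series → Series
(⊝ a) n = - a n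

𝟘 𝟙 : Series
𝟘 _ = 0ℤ
𝟙 zero = 1ℤ
𝟙 (suc _) = 0ℤ

_·_ : ℤ → Series → Series
(x · a) n = x * a n

shift : Series → Series
shift a n = a (suc n)

_⊛_ : Series → Series → Series
(a ⊛ b) zero = a 0 * b 0
(a ⊛ b) (suc n) = a 0 * b (suc n) + (shift a ⊛ b) n

⊛-congʳ : ∀ {a a′} b → a ≗ a′ → a ⊛ b ≗ a′ ⊛ b
⊛-congʳ b e zero = cong (_* b 0) (e 0)
⊛-congʳ b e (suc n) = cong₂ _+_ (cong (_* b (suc n)) (e 0)) (⊛-congʳ b (e ∘ suc) n)

⊛-zeroˡ : ∀ b → 𝟘 ⊛ b ≗ 𝟘
⊛-zeroˡ b zero = ℤP.*-zeroˡ (b 0)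
⊛-zeroˡ b (suc n) = cong₂ _+_ (ℤP.*-zeroˡ (b (suc n))) (⊛-zeroˡ b n)

⊛-identityˡ : ∀ a → 𝟙 ⊛ a ≗ a
⊛-identityˡ a zero = ℤP.*-identityˡ (a 0)
⊛-identityˡ a (suc n) = trans (cong₂ _+_ (ℤP.*-identityˡ (a (suc n))) (⊛-zeroˡ a n)) (ℤP.+-identityʳ (a (suc n)))

⊛-shiftʳ : ∀ a b n → (a ⊛ b) (suc n) ≡ (a ⊛ shift b) n + a (suc n) * b 0
⊛-shiftʳ a b zero = refl
⊛-shiftʳ a b (suc n) = trans (cong (_+_ (a 0 * b (suc (suc n)))) (⊛-shiftʳ (shift a) b n))
  (sym (ℤP.+-assoc (a 0 * b (suc (suc n))) _ _))

⊛-comm : ∀ a b → a ⊛ b ≗ b ⊛ a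
⊛-comm a b zero = ℤP.*-comm (a 0) (b 0)
⊛-comm a b (suc n) = begin
  a 0 * b (suc n) + (shift a ⊛ b) n ≡⟨ cong₂ _+_ (ℤP.*-comm (a 0) _) (⊛-comm (shift a) b n) ⟩
  b (suc n) * a 0 + (b ⊛ shift a) n ≡⟨ ℤP.+-comm (b (suc n) * a 0) _ ⟩
  (b ⊛ shift a) n + b (suc n) * a 0 ≡⟨ sym (⊛-shiftʳ b a n) ⟩
  (b ⊛ a) (suc n)                   ∎
  where open ≡-Reasoning

⊛-congˡ : ∀ a {b b′} → b ≗ b′ → a ⊛ b ≗ a ⊛ b′
⊛-congˡ a {b} {b′} e n = trans (⊛-comm a b n) (trans (⊛-congʳ a e n) (⊛-comm b′ a n))

⊛-distribʳ : ∀ a b c → (a ⊕ b) ⊛ c ≗ a ⊛ c ⊕ b ⊛ c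
⊛-distribʳ a b c zero = ℤP.*-distribʳ-+ (c 0) (a 0) (b 0)
⊛-distribʳ a b c (suc n) =
  trans (cong₂ _+_ (ℤP.*-distribʳ-+ (c (suc n)) (a 0) (b 0)) (⊛-distribʳ (shift a) (shift b) c n))
        (interchange (a 0 * c (suc n)) (b 0 * c (suc n)) _ _)
  where
  interchange : ∀ x y z w → (x + y) + (z + w) ≡ (x + z) + (y + w)
  interchange = solve-∀

·-⊛ : ∀ x a b → x · a ⊛ b ≗ x · (a ⊛ b)
·-⊛ x a b zero = ℤP.*-assoc x (a 0) (b 0)
·-⊛ x a b (suc n) = trans (cong₂ _+_ (ℤP.*-assoc x (a 0) _) (·-⊛ x (shift a) b n))
  (sym (ℤP.*-distribˡ-+ x (a 0 * b (suc n)) _))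

⊛-assoc : ∀ a b c → (a ⊛ b) ⊛ c ≗ a ⊛ (b ⊛ c)
⊛-assoc a b c zero = ℤP.*-assoc (a 0) (b 0) (c 0)
⊛-assoc a b c (suc n) = begin
  (a 0 * b 0) * c (suc n) + (shift (a ⊛ b) ⊛ c) n
    ≡⟨ cong (_+_ ((a 0 * b 0) * c (suc n))) (⊛-distribʳ (a 0 · shift b) (shift a ⊛ b) c n) ⟩
  (a 0 * b 0) * c (suc n) + ((a 0 · shift b ⊛ c) n + ((shift a ⊛ b) ⊛ c) n)
    ≡⟨ cong₂ (λ u v → (a 0 * b 0) * c (suc n) + (u + v)) (·-⊛ (a 0) (shift b) c n) (⊛-assoc (shift a) b c n) ⟩
  (a 0 * b 0) * c (suc n) + (a 0 * (shift b ⊛ c) n + (shift a ⊛ (b ⊛ c)) n)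
    ≡⟨ regroup (a 0) (b 0) (c (suc n)) _ _ ⟩
  a 0 * (b 0 * c (suc n) + (shift b ⊛ c) n) + (shift a ⊛ (b ⊛ c)) n ∎
  where
  open ≡-Reasoning
  regroup : ∀ x y z u v → (x * y) * z + (x * u + v) ≡ x * (y * z + u) + v
  regroup = solve-∀

-- The Leibniz rule is proved for the Euler operator θ = x d/dx, of which d/dx is the shift.
θ : Series → Series
θ a n = + n * a n

θ-⊛ : ∀ a b → θ (a ⊛ b) ≗ θ a ⊛ b ⊕ a ⊛ θ b
θ-⊛ a b zero = trans (ℤP.*-zeroˡ (a 0 * b 0))
  (sym (cong₂ _+_ (ℤP.*-zeroˡ (b 0)) (trans (cong (a 0 *_) (ℤP.*-zeroˡ (b 0))) (ℤP.*-zeroʳ (a 0)))))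
θ-⊛ a b (suc n) = begin
  (1ℤ + N) * (a 0 * b (suc n) + S)
    ≡⟨ expand N (a 0) (b (suc n)) S ⟩
  (0ℤ * a 0) * b (suc n) + (N * S + S) + a 0 * ((1ℤ + N) * b (suc n))
    ≡⟨ cong (λ t → (0ℤ * a 0) * b (suc n) + (t + S) + a 0 * ((1ℤ + N) * b (suc n))) (θ-⊛ (shift a) b n) ⟩
  (0ℤ * a 0) * b (suc n) + ((T + U) + S) + a 0 * ((1ℤ + N) * b (suc n))
    ≡⟨ regroup (0ℤ * a 0) (b (suc n)) T U S (a 0 * ((1ℤ + N) * b (suc n))) ⟩
  (0ℤ * a 0) * b (suc n) + (T + S) + (a 0 * ((1ℤ + N) * b (suc n)) + U)
    ≡⟨ cong (λ t → (0ℤ * a 0) * b (suc n) + t + (a 0 * ((1ℤ + N) * b (suc n)) + U)) (sym shift-θ) ⟩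
  (0ℤ * a 0) * b (suc n) + (shift (θ a) ⊛ b) n + (a 0 * ((1ℤ + N) * b (suc n)) + (shift a ⊛ θ b) n) ∎
  where
  open ≡-Reasoning
  N = + n
  S = (shift a ⊛ b) n
  T = (θ (shift a) ⊛ b) n
  U = (shift a ⊛ θ b) n
  shift-θ : (shift (θ a) ⊛ b) n ≡ T + S
  shift-θ = trans (⊛-congʳ b (λ k → ℤP.*-distribʳ-+ (a (suc k)) 1ℤ (+ k)) n)
    (trans (⊛-distribʳ (λ k → 1ℤ * a (suc k)) (θ (shift a)) b n)
      (trans (ℤP.+-comm _ T) (cong (_+_ T) (⊛-congʳ b (ℤP.*-identityˡ ∘ shift a) n))))
  expand : ∀ N x y S → (1ℤ + N) * (x * y + S) ≡ (0ℤ * x) * y + (N * S + S) + x * ((1ℤ + N) * y)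
  expand = solve-∀
  regroup : ∀ z y T U S W → z * y + ((T + U) + S) + W ≡ z * y + (T + S) + (W + U)
  regroup = solve-∀

deriv-⊛ : ∀ a b → deriv (a ⊛ b) ≗ deriv a ⊛ b ⊕ a ⊛ deriv b
deriv-⊛ a b n = trans (θ-⊛ a b (suc n)) (cong₂ _+_ θ-left θ-right)
  where
  θ-left : (θ a ⊛ b) (suc n) ≡ (deriv a ⊛ b) n
  θ-left = trans (cong (_+ (shift (θ a) ⊛ b) n)
    (trans (cong (_* b (suc n)) (ℤP.*-zeroˡ (a 0))) (ℤP.*-zeroˡ (b (suc n))))) (ℤP.+-identityˡ _)
  θ-right : (a ⊛ θ b) (suc n) ≡ (a ⊛ deriv b) n
  θ-right = trans (⊛-shiftʳ a (θ b) n)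
    (trans (cong (_+_ ((a ⊛ shift (θ b)) n)) (trans (cong (a (suc n) *_) (ℤP.*-zeroˡ (b 0))) (ℤP.*-zeroʳ (a (suc n)))))
      (ℤP.+-identityʳ _))

infixr 8 _^ˢ_

_^ˢ_ : Series → ℕ → Series
a ^ˢ zero = 𝟙
a ^ˢ suc k = a ⊛ a ^ˢ k

sumTo : ℕ → (ℕ → ℤ) → ℤ
sumTo zero h = 0ℤ
sumTo (suc n) h = h 0 + sumTo n (h ∘ suc)

sumTo-zero : ∀ n h → (∀ i → i < n → h i ≡ 0ℤ) → sumTo n h ≡ 0ℤ
sumTo-zero zero h _ = refl
sumTo-zero (suc n) h h≡0 = cong₂ _+_ (h≡0 0 (s≤s z≤n)) (sumTo-zero n (h ∘ suc) (λ i i<n → h≡0 (suc i) (s≤s i<n)))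

sumTo-single : ∀ n h k → k < n → (∀ i → i < n → i ≢ k → h i ≡ 0ℤ) → sumTo n h ≡ h k
sumTo-single (suc n) h zero _ h≡0 =
  trans (cong (_+_ (h 0)) (sumTo-zero n (h ∘ suc) (λ i i<n → h≡0 (suc i) (s≤s i<n) (λ ())))) (ℤP.+-identityʳ (h 0))
sumTo-single (suc n) h (suc k) (s≤s k<n) h≡0 =
  trans (cong (_+ sumTo n (h ∘ suc)) (h≡0 0 (s≤s z≤n) (λ ())))
    (trans (ℤP.+-identityˡ _) (sumTo-single n (h ∘ suc) k k<n (λ i i<n i≢k → h≡0 (suc i) (s≤s i<n) (i≢k ∘ ℕP.suc-injective))))

⊛-sumTo : ∀ a b n → (a ⊛ b) n ≡ sumTo (suc n) (λ i → a i * b (n ∸ i))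
⊛-sumTo a b zero = sym (ℤP.+-identityʳ _)
⊛-sumTo a b (suc n) = cong (_+_ (a 0 * b (suc n))) (⊛-sumTo (shift a) b n)

-- Polynomials as series

⟦_⟧ : Poly → Series
⟦ A ⟧ = coeff A

coeff-addP : ∀ A B → ⟦ addP A B ⟧ ≗ ⟦ A ⟧ ⊕ ⟦ B ⟧
coeff-addP [] B n = sym (ℤP.+-identityˡ _)
coeff-addP (c ∷ cs) [] n = sym (ℤP.+-identityʳ _)
coeff-addP (c ∷ cs) (d ∷ ds) zero = refl
coeff-addP (c ∷ cs) (d ∷ ds) (suc n) = coeff-addP cs ds n

coeff-map-* : ∀ c B → ⟦ map (c *_) B ⟧ ≗ c · ⟦ B ⟧
coeff-map-* c [] n = sym (ℤP.*-zeroʳ c)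
coeff-map-* c (d ∷ ds) zero = refl
coeff-map-* c (d ∷ ds) (suc n) = coeff-map-* c ds n

coeff-mulP : ∀ A B → ⟦ mulP A B ⟧ ≗ ⟦ A ⟧ ⊛ ⟦ B ⟧
coeff-mulP [] B n = sym (⊛-zeroˡ ⟦ B ⟧ n)
coeff-mulP (c ∷ cs) B zero =
  trans (coeff-addP (map (c *_) B) (0ℤ ∷ mulP cs B) zero) (trans (ℤP.+-identityʳ _) (coeff-map-* c B zero))
coeff-mulP (c ∷ cs) B (suc n) =
  trans (coeff-addP (map (c *_) B) (0ℤ ∷ mulP cs B) (suc n)) (cong₂ _+_ (coeff-map-* c B (suc n)) (coeff-mulP cs B n))

coeff-powP : ∀ C k → ⟦ powP C k ⟧ ≗ ⟦ C ⟧ ^ˢ k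
coeff-powP C zero zero = refl
coeff-powP C zero (suc n) = refl
coeff-powP C (suc k) n = trans (coeff-mulP C (powP C k) n) (⊛-congˡ ⟦ C ⟧ (coeff-powP C k) n)

mulPS-⊛ : ∀ P f → mulPS P f ≗ ⟦ P ⟧ ⊛ f
mulPS-⊛ [] f n = sym (⊛-zeroˡ f n)
mulPS-⊛ (c ∷ cs) f zero = refl
mulPS-⊛ (c ∷ cs) f (suc n) = cong (_+_ (c * f (suc n))) (mulPS-⊛ cs f n)

negP : Poly → Poly
negP = map (λ x → - x)

coeff-negP : ∀ A → ⟦ negP A ⟧ ≗ ⊝ ⟦ A ⟧
coeff-negP [] n = refl
coeff-negP (c ∷ cs) zero = refl
coeff-negP (c ∷ cs) (suc n) = coeff-negP cs n

subP : Poly → Poly → Poly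
subP A B = addP A (negP B)

coeff-subP : ∀ A B → ⟦ subP A B ⟧ ≗ ⟦ A ⟧ ⊕ ⊝ ⟦ B ⟧
coeff-subP A B n = trans (coeff-addP A (negP B) n) (cong (_+_ (coeff A n)) (coeff-negP B n))

derivP-from : ℕ → Poly → Poly
derivP-from k [] = []
derivP-from k (c ∷ cs) = (+ k * c) ∷ derivP-from (suc k) cs

derivP : Poly → Poly
derivP [] = []
derivP (c ∷ cs) = derivP-from 1 cs

coeff-derivP-from : ∀ k cs n → coeff (derivP-from k cs) n ≡ + (k ℕ.+ n) * coeff cs n
coeff-derivP-from k [] n = sym (ℤP.*-zeroʳ (+ (k ℕ.+ n)))
coeff-derivP-from k (c ∷ cs) zero = cong (λ t → + t * c) (sym (ℕP.+-identityʳ k))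
coeff-derivP-from k (c ∷ cs) (suc n) =
  trans (coeff-derivP-from (suc k) cs n) (cong (λ t → + t * coeff cs n) (sym (ℕP.+-suc k n)))

coeff-derivP : ∀ A → ⟦ derivP A ⟧ ≗ deriv ⟦ A ⟧
coeff-derivP [] n = sym (ℤP.*-zeroʳ (+ suc n))
coeff-derivP (c ∷ cs) n = coeff-derivP-from 1 cs n

module ModuloP (p : ℕ) where

  open import Data.Integer.Divisibility.Signed using (_∣_; _∣?_; divides; ∣m∣n⇒∣m+n; ∣m⇒∣-m; ∣n⇒∣m*n; ∣m⇒∣m*n; ∣⇒∣ᵤ)
  import Data.Nat.Divisibility as ℕ∣
  open import Algebra.Bundles using (CommutativeRing)
  open import Algebra.Solver.Ring.AlmostCommutativeRing
    using (fromCommutativeRing; _-Raw-AlmostCommutative⟶_)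
  open import Data.Maybe using (Maybe; just; nothing)
  import Algebra.Solver.Ring

  infix 4 p∣_ _≈_

  p∣_ : ℤ → Set
  p∣ x = + p ∣ x

  p∣0 : p∣ 0ℤ
  p∣0 = divides 0ℤ refl

  p∣+ : ∀ {x y} → p∣ x → p∣ y → p∣ (x + y)
  p∣+ = ∣m∣n⇒∣m+n

  p∣- : ∀ {x} → p∣ x → p∣ (- x)
  p∣- = ∣m⇒∣-m

  p∣*ˡ : ∀ x {y} → p∣ y → p∣ (x * y)
  p∣*ˡ x = ∣n⇒∣m*n x

  p∣*ʳ : ∀ {x} y → p∣ x → p∣ (x * y)
  p∣*ʳ y = ∣m⇒∣m*n y

  p∣x-x : ∀ x → p∣ (x - x)
  p∣x-x x = subst p∣_ (sym (ℤP.+-inverseʳ x)) p∣0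

  record _≈_ (a b : Series) : Set where
    constructor mk≈
    field p∣coeff-diff : ∀ n → p∣ (a n - b n)
  open _≈_ public

  private
    sub-swap : ∀ x y → y - x ≡ - (x - y)
    sub-swap = solve-∀
    sub-via : ∀ x y z → (x - y) + (y - z) ≡ x - z
    sub-via = solve-∀
    sub-+ : ∀ x y x′ y′ → (x - x′) + (y - y′) ≡ (x + y) - (x′ + y′)
    sub-+ = solve-∀
    sub-* : ∀ x y x′ y′ → x * (y - y′) + (x - x′) * y′ ≡ x * y - x′ * y′
    sub-* = solve-∀
    sub-neg : ∀ x y → - (x - y) ≡ - x - - y
    sub-neg = solve-∀

  ≗⇒≈ : ∀ {a b} → a ≗ b → a ≈ b
  ≗⇒≈ {a} e = mk≈ λ n → subst (λ t → p∣ (a n - t)) (e n) (p∣x-x (a n))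

  ≈-refl : ∀ {a} → a ≈ a
  ≈-refl = ≗⇒≈ λ _ → refl

  ≈-sym : ∀ {a b} → a ≈ b → b ≈ a
  ≈-sym {a} {b} (mk≈ e) = mk≈ λ n → subst p∣_ (sym (sub-swap (a n) (b n))) (p∣- (e n))

  ≈-trans : ∀ {a b c} → a ≈ b → b ≈ c → a ≈ c
  ≈-trans {a} {b} {c} (mk≈ e) (mk≈ f) = mk≈ λ n → subst p∣_ (sub-via (a n) (b n) (c n)) (p∣+ (e n) (f n))

  ⊕-cong : ∀ {a a′ b b′} → a ≈ a′ → b ≈ b′ → a ⊕ b ≈ a′ ⊕ b′
  ⊕-cong {a} {a′} {b} {b′} (mk≈ e) (mk≈ f) =
    mk≈ λ n → subst p∣_ (sub-+ (a n) (b n) (a′ n) (b′ n)) (p∣+ (e n) (f n))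

  ⊝-cong : ∀ {a a′} → a ≈ a′ → ⊝ a ≈ ⊝ a′
  ⊝-cong {a} {a′} (mk≈ e) = mk≈ λ n → subst p∣_ (sub-neg (a n) (a′ n)) (p∣- (e n))

  ⊛-cong : ∀ {a a′ b b′} → a ≈ a′ → b ≈ b′ → a ⊛ b ≈ a′ ⊛ b′
  ⊛-cong (mk≈ e) (mk≈ f) = mk≈ (p∣diff e f)
    where
    p∣diff : ∀ {a a′ b b′} → (∀ n → p∣ (a n - a′ n)) → (∀ n → p∣ (b n - b′ n)) → ∀ n → p∣ ((a ⊛ b) n - (a′ ⊛ b′) n)
    p∣diff {a} {a′} {b} {b′} e f zero = subst p∣_ (sub-* (a 0) (b 0) (a′ 0) (b′ 0)) (p∣+ (p∣*ˡ (a 0) (f 0)) (p∣*ʳ (b′ 0) (e 0)))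
    p∣diff {a} {a′} {b} {b′} e f (suc n) =
      subst p∣_ (sub-+ (a 0 * b (suc n)) ((shift a ⊛ b) n) (a′ 0 * b′ (suc n)) ((shift a′ ⊛ b′) n))
        (p∣+ (subst p∣_ (sub-* (a 0) (b (suc n)) (a′ 0) (b′ (suc n))) (p∣+ (p∣*ˡ (a 0) (f (suc n))) (p∣*ʳ (b′ (suc n)) (e 0))))
             (p∣diff (e ∘ suc) f n))

  𝔽ₚ⟦x⟧ : CommutativeRing _ _
  𝔽ₚ⟦x⟧ = record
    { Carrier = Series ; _≈_ = _≈_ ; _+_ = _⊕_ ; _*_ = _⊛_ ; -_ = ⊝_ ; 0# = 𝟘 ; 1# = 𝟙
    ; isCommutativeRing = record
      { isRing = record
        { +-isAbelianGroup = record
          { isGroup = record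
            { isMonoid = record
              { isSemigroup = record
                { isMagma = record
                  { isEquivalence = record { refl = ≈-refl ; sym = ≈-sym ; trans = ≈-trans }
                  ; ∙-cong = ⊕-cong }
                ; assoc = λ a b c → ≗⇒≈ λ n → ℤP.+-assoc (a n) (b n) (c n) }
              ; identity = (λ a → ≗⇒≈ λ n → ℤP.+-identityˡ (a n)) , (λ a → ≗⇒≈ λ n → ℤP.+-identityʳ (a n)) }
            ; inverse = (λ a → ≗⇒≈ λ n → ℤP.+-inverseˡ (a n)) , (λ a → ≗⇒≈ λ n → ℤP.+-inverseʳ (a n))
            ; ⁻¹-cong = ⊝-cong }
          ; comm = λ a b → ≗⇒≈ λ n → ℤP.+-comm (a n) (b n) }
        ; *-cong = ⊛-cong
        ; *-assoc = λ a b c → ≗⇒≈ (⊛-assoc a b c)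
        ; *-identity = (λ a → ≗⇒≈ (⊛-identityˡ a)) , (λ a → ≗⇒≈ λ n → trans (⊛-comm a 𝟙 n) (⊛-identityˡ a n))
        ; distrib = (λ a b c → ≗⇒≈ λ n → trans (⊛-comm a (b ⊕ c) n) (trans (⊛-distribʳ b c a n) (cong₂ _+_ (⊛-comm b a n) (⊛-comm c a n))))
                  , (λ a b c → ≗⇒≈ (⊛-distribʳ b c a)) }
      ; *-comm = λ a b → ≗⇒≈ (⊛-comm a b) } }

  const : ℤ → Series
  const c = ⟦ c ∷ [] ⟧

  const-homomorphism : CommutativeRing.rawRing ℤP.+-*-commutativeRing -Raw-AlmostCommutative⟶ fromCommutativeRing 𝔽ₚ⟦x⟧
  const-homomorphism = record
    { ⟦_⟧ = const
    ; +-homo = λ x y → ≗⇒≈ λ { zero → refl ; (suc n) → refl }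
    ; *-homo = λ x y → ≗⇒≈ λ { zero → refl ; (suc n) →
        sym (trans (cong (_+_ (x * 0ℤ)) (⊛-zeroˡ (const y) n)) (trans (ℤP.+-identityʳ _) (ℤP.*-zeroʳ x))) }
    ; -‿homo = λ x → ≗⇒≈ λ { zero → refl ; (suc n) → refl }
    ; 0-homo = ≗⇒≈ λ { zero → refl ; (suc n) → refl }
    ; 1-homo = ≗⇒≈ λ { zero → refl ; (suc n) → refl }
    }

  const-≟ : (x y : ℤ) → Maybe (const x ≈ const y)
  const-≟ x y with x ℤ.≟ y
  ... | yes refl = just ≈-refl
  ... | no _ = nothing

  open Algebra.Solver.Ring (CommutativeRing.rawRing ℤP.+-*-commutativeRing) (fromCommutativeRing 𝔽ₚ⟦x⟧) const-homomorphism const-≟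
    public using (solve; _:=_; _:+_; _:*_; :-_; con)

  *-congˡ : ∀ a {b b′} → b ≈ b′ → a ⊛ b ≈ a ⊛ b′
  *-congˡ a = ⊛-cong (≈-refl {a})

  *-congʳ : ∀ b {a a′} → a ≈ a′ → a ⊛ b ≈ a′ ⊛ b
  *-congʳ b e = ⊛-cong e (≈-refl {b})

  +-congˡ : ∀ a {b b′} → b ≈ b′ → a ⊕ b ≈ a ⊕ b′
  +-congˡ a = ⊕-cong (≈-refl {a})

  +-congʳ : ∀ b {a a′} → a ≈ a′ → a ⊕ b ≈ a′ ⊕ b
  +-congʳ b e = ⊕-cong e (≈-refl {b})

  open import Relation.Binary.Reasoning.Setoid (CommutativeRing.setoid 𝔽ₚ⟦x⟧) public

  const-0 : const 0ℤ ≈ 𝟘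
  const-0 = ≗⇒≈ λ { zero → refl ; (suc n) → refl }

  const-1 : const 1ℤ ≈ 𝟙
  const-1 = ≗⇒≈ λ { zero → refl ; (suc n) → refl }

  const-+ : ∀ x y → const (x + y) ≈ const x ⊕ const y
  const-+ = _-Raw-AlmostCommutative⟶_.+-homo const-homomorphism

  const-* : ∀ x y → const (x * y) ≈ const x ⊛ const y
  const-* = _-Raw-AlmostCommutative⟶_.*-homo const-homomorphism

  const-cong : ∀ {x y} → p∣ (x - y) → const x ≈ const y
  const-cong d = mk≈ λ { zero → d ; (suc n) → p∣0 }

  ≈𝟘⇒p∣ : ∀ {a} → a ≈ 𝟘 → ∀ n → p∣ a n
  ≈𝟘⇒p∣ {a} (mk≈ e) n = subst p∣_ (ℤP.+-identityʳ (a n)) (e n)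

  p∣⇒≈𝟘 : ∀ {a} → (∀ n → p∣ a n) → a ≈ 𝟘
  p∣⇒≈𝟘 {a} e = mk≈ λ n → subst p∣_ (sym (ℤP.+-identityʳ (a n))) (e n)

  p∣-resp-≈ : ∀ {a b} → a ≈ b → ∀ n → p∣ a n → p∣ b n
  p∣-resp-≈ {a} {b} (mk≈ e) n d = subst p∣_ (cancel (a n) (b n)) (p∣+ d (p∣- (e n)))
    where
    cancel : ∀ x y → x + - (x - y) ≡ y
    cancel = solve-∀

  ⊛-zeroₚ : ∀ {a} b → a ≈ 𝟘 → a ⊛ b ≈ 𝟘
  ⊛-zeroₚ b z = ≈-trans (*-congʳ b z) (≗⇒≈ (⊛-zeroˡ b))

  ^ˢ-+ : ∀ a m n → a ^ˢ (m ℕ.+ n) ≈ a ^ˢ m ⊛ a ^ˢ n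
  ^ˢ-+ a zero n = ≈-sym (≗⇒≈ (⊛-identityˡ (a ^ˢ n)))
  ^ˢ-+ a (suc m) n = ≈-trans (*-congˡ a (^ˢ-+ a m n)) (≗⇒≈ λ k → sym (⊛-assoc a (a ^ˢ m) (a ^ˢ n) k))

  deriv-cong : ∀ {a b} → a ≈ b → deriv a ≈ deriv b
  deriv-cong {a} {b} (mk≈ e) = mk≈ λ n →
    subst p∣_ (factor (+ suc n) (a (suc n)) (b (suc n))) (p∣*ˡ (+ suc n) (e (suc n)))
    where
    factor : ∀ N x y → N * (x - y) ≡ N * x - N * y
    factor = solve-∀

  deriv-^ˢ : ∀ a j → deriv (a ^ˢ suc j) ≈ const (+ suc j) ⊛ (deriv a ⊛ a ^ˢ j)
  deriv-^ˢ a zero = begin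
    deriv (a ⊛ 𝟙)                   ≈⟨ ≗⇒≈ (deriv-⊛ a 𝟙) ⟩
    deriv a ⊛ 𝟙 ⊕ a ⊛ deriv 𝟙       ≈⟨ +-congˡ (deriv a ⊛ 𝟙) (*-congˡ a deriv-𝟙) ⟩
    deriv a ⊛ 𝟙 ⊕ a ⊛ const 0ℤ      ≈⟨ solve 2 (λ x a → x :+ a :* con 0ℤ := con 1ℤ :* x) ≈-refl (deriv a ⊛ 𝟙) a ⟩
    const 1ℤ ⊛ (deriv a ⊛ 𝟙)        ∎
    where
    deriv-𝟙 : deriv 𝟙 ≈ const 0ℤ
    deriv-𝟙 = ≗⇒≈ λ { zero → ℤP.*-zeroʳ (+ 1) ; (suc n) → ℤP.*-zeroʳ (+ suc (suc n)) }
  deriv-^ˢ a (suc j) = begin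
    deriv (a ⊛ a ^ˢ suc j)
      ≈⟨ ≗⇒≈ (deriv-⊛ a (a ^ˢ suc j)) ⟩
    deriv a ⊛ (a ⊛ a ^ˢ j) ⊕ a ⊛ deriv (a ^ˢ suc j)
      ≈⟨ +-congˡ (deriv a ⊛ (a ⊛ a ^ˢ j)) (*-congˡ a (deriv-^ˢ a j)) ⟩
    deriv a ⊛ (a ⊛ a ^ˢ j) ⊕ a ⊛ (const (+ suc j) ⊛ (deriv a ⊛ a ^ˢ j))
      ≈⟨ solve 4 (λ d a P K → d :* (a :* P) :+ a :* (K :* (d :* P)) := (con 1ℤ :+ K) :* (d :* (a :* P))) ≈-refl
           (deriv a) a (a ^ˢ j) (const (+ suc j)) ⟩
    (const 1ℤ ⊕ const (+ suc j)) ⊛ (deriv a ⊛ (a ⊛ a ^ˢ j))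
      ≈⟨ *-congʳ (deriv a ⊛ (a ⊛ a ^ˢ j)) (≈-sym (const-+ 1ℤ (+ suc j))) ⟩
    const (+ suc (suc j)) ⊛ (deriv a ⊛ (a ⊛ a ^ˢ j)) ∎

  p∣? : ∀ x → Dec (p∣ x)
  p∣? x = + p ∣? x

  p∤+ : ∀ {s} → 1 ≤ s → s < p → ¬ p∣ (+ s)
  p∤+ {suc s} _ s<p d = ℕP.<⇒≱ s<p (ℕ∣.∣⇒≤ (∣⇒∣ᵤ d))

  DegLt : Series → ℕ → Set
  DegLt a d = ∀ n → d ≤ n → p∣ a n

  record Deg (a : Series) (d : ℕ) : Set where
    constructor mkDeg
    field
      higher-vanish : DegLt a (suc d)
      leading-nonzero : ¬ p∣ a d

  DegLt-resp-≈ : ∀ {a b d} → a ≈ b → DegLt a d → DegLt b d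
  DegLt-resp-≈ e s n le = p∣-resp-≈ e n (s n le)

  Deg-resp-≈ : ∀ {a b d} → a ≈ b → Deg a d → Deg b d
  Deg-resp-≈ {d = d} e (mkDeg s t) = mkDeg (DegLt-resp-≈ e s) λ x → t (p∣-resp-≈ (≈-sym e) d x)

  DegLt-mono : ∀ {a d e} → d ≤ e → DegLt a d → DegLt a e
  DegLt-mono le s n l = s n (ℕP.≤-trans le l)

  Deg⇒< : ∀ {a d N} → Deg a d → DegLt a N → d < N
  Deg⇒< {d = d} {N} (mkDeg _ t) s = ℕP.≰⇒> (λ N≤d → t (s d N≤d))

  Deg-unique : ∀ {a d e} → Deg a d → Deg a e → d ≡ e
  Deg-unique da@(mkDeg sd _) de@(mkDeg se _) =
    ℕP.≤-antisym (ℕP.≤-pred (Deg⇒< da se)) (ℕP.≤-pred (Deg⇒< de sd))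

  Deg⇒≉𝟘 : ∀ {a d} → Deg a d → ¬ a ≈ 𝟘
  Deg⇒≉𝟘 {d = d} (mkDeg _ t) z = t (≈𝟘⇒p∣ z d)

  DegLt-length : ∀ A → DegLt ⟦ A ⟧ (length A)
  DegLt-length [] n _ = p∣0
  DegLt-length (c ∷ cs) (suc n) (s≤s le) = DegLt-length cs n le

  ≈𝟘-or-Deg : ∀ A → ⟦ A ⟧ ≈ 𝟘 ⊎ ∃ (Deg ⟦ A ⟧)
  ≈𝟘-or-Deg [] = inj₁ (p∣⇒≈𝟘 λ _ → p∣0)
  ≈𝟘-or-Deg (c ∷ cs) with ≈𝟘-or-Deg cs
  ... | inj₂ (d , mkDeg s t) = inj₂ (suc d , mkDeg (λ { (suc n) (s≤s le) → s n le }) t)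
  ... | inj₁ z with p∣? c
  ...   | yes p∣c = inj₁ (p∣⇒≈𝟘 λ { zero → p∣c ; (suc n) → ≈𝟘⇒p∣ z n })
  ...   | no p∤c = inj₂ (0 , mkDeg (λ { (suc n) _ → ≈𝟘⇒p∣ z n }) p∤c)

  ⊛-DegLt : ∀ da db a b → DegLt a (suc da) → DegLt b (suc db) →
    DegLt (a ⊛ b) (suc (da ℕ.+ db)) × p∣ ((a ⊛ b) (da ℕ.+ db) - a da * b db)
  ⊛-DegLt zero db a b sa sb = high , top db
    where
    shift-a≈𝟘 : shift a ≈ 𝟘
    shift-a≈𝟘 = p∣⇒≈𝟘 λ n → sa (suc n) (s≤s z≤n)
    high : DegLt (a ⊛ b) (suc db)
    high (suc n) (s≤s le) = p∣+ (p∣*ˡ (a 0) (sb (suc n) (s≤s le))) (≈𝟘⇒p∣ (⊛-zeroₚ b shift-a≈𝟘) n)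
    top : ∀ d → p∣ ((a ⊛ b) d - a 0 * b d)
    top zero = p∣x-x (a 0 * b 0)
    top (suc n) = subst p∣_ (sym (+-minus (a 0 * b (suc n)) _)) (≈𝟘⇒p∣ (⊛-zeroₚ b shift-a≈𝟘) n)
      where
      +-minus : ∀ x y → (x + y) - x ≡ y
      +-minus = solve-∀
  ⊛-DegLt (suc e) db a b sa sb = high , top
    where
    ih = ⊛-DegLt e db (shift a) b (λ n le → sa (suc n) (s≤s le)) sb
    high : DegLt (a ⊛ b) (suc (suc e ℕ.+ db))
    high (suc n) (s≤s le) = p∣+ (p∣*ˡ (a 0) (sb (suc n) (s≤s (ℕP.≤-trans (ℕP.m≤n+m db (suc e)) le)))) (proj₁ ih n le)
    top : p∣ ((a ⊛ b) (suc (e ℕ.+ db)) - a (suc e) * b db)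
    top = subst p∣_ (sym (+-assoc-minus (a 0 * b (suc (e ℕ.+ db))) _ _))
      (p∣+ (p∣*ˡ (a 0) (sb (suc (e ℕ.+ db)) (s≤s (ℕP.m≤n+m db e)))) (proj₂ ih))
      where
      +-assoc-minus : ∀ x y z → (x + y) - z ≡ x + (y - z)
      +-assoc-minus = solve-∀

  ⊛-unit-cancel-𝟘 : ∀ {g} → g 0 ≡ 1ℤ → ∀ b → b ⊛ g ≈ 𝟘 → b ≈ 𝟘
  ⊛-unit-cancel-𝟘 {g} g₀≡1 b bg≈𝟘 = p∣⇒≈𝟘 (λ n → p∣coefficients n b bg≈𝟘)
    where
    p∣b₀ : ∀ b → b ⊛ g ≈ 𝟘 → p∣ b 0
    p∣b₀ b bg≈𝟘 = subst p∣_ (trans (cong (b 0 *_) g₀≡1) (ℤP.*-identityʳ (b 0))) (≈𝟘⇒p∣ bg≈𝟘 0)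
    p∣coefficients : ∀ n b → b ⊛ g ≈ 𝟘 → p∣ b n
    p∣coefficients zero b bg≈𝟘 = p∣b₀ b bg≈𝟘
    p∣coefficients (suc n) b bg≈𝟘 = p∣coefficients n (shift b) (p∣⇒≈𝟘 λ m →
      subst p∣_ (cancel (b 0 * g (suc m)) ((shift b ⊛ g) m)) (p∣+ (≈𝟘⇒p∣ bg≈𝟘 (suc m)) (p∣- (p∣*ʳ (g (suc m)) (p∣b₀ b bg≈𝟘)))))
      where
      cancel : ∀ x y → (x + y) + - x ≡ y
      cancel = solve-∀

  applyOp-⊛-constant : ∀ {g} → deriv g ≈ 𝟘 → ∀ L h a → h ≈ a ⊛ g → applyOp L h ≈ applyOp L a ⊛ g
  applyOp-⊛-constant {g} g′≈𝟘 [] h a h≈ag = ≈-sym (≗⇒≈ (⊛-zeroˡ g))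
  applyOp-⊛-constant {g} g′≈𝟘 (P ∷ Ps) h a h≈ag = begin
    mulPS P h ⊕ applyOp Ps (deriv h)
      ≈⟨ ⊕-cong (≗⇒≈ (mulPS-⊛ P h)) (applyOp-⊛-constant g′≈𝟘 Ps (deriv h) (deriv a) h′≈a′g) ⟩
    ⟦ P ⟧ ⊛ h ⊕ applyOp Ps (deriv a) ⊛ g
      ≈⟨ +-congʳ (applyOp Ps (deriv a) ⊛ g) (≈-trans (*-congˡ ⟦ P ⟧ h≈ag)
           (≈-trans (≗⇒≈ λ n → sym (⊛-assoc ⟦ P ⟧ a g n)) (*-congʳ g (≈-sym (≗⇒≈ (mulPS-⊛ P a)))))) ⟩
    mulPS P a ⊛ g ⊕ applyOp Ps (deriv a) ⊛ g ≈⟨ ≈-sym (≗⇒≈ (⊛-distribʳ (mulPS P a) (applyOp Ps (deriv a)) g)) ⟩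
    (mulPS P a ⊕ applyOp Ps (deriv a)) ⊛ g ∎
    where
    h′≈a′g : deriv h ≈ deriv a ⊛ g
    h′≈a′g = begin
      deriv h ≈⟨ deriv-cong h≈ag ⟩
      deriv (a ⊛ g) ≈⟨ ≗⇒≈ (deriv-⊛ a g) ⟩
      deriv a ⊛ g ⊕ a ⊛ deriv g ≈⟨ +-congˡ (deriv a ⊛ g) (≈-trans (*-congˡ a g′≈𝟘) (≗⇒≈ λ n → trans (⊛-comm a 𝟘 n) (⊛-zeroˡ a n))) ⟩
      deriv a ⊛ g ⊕ 𝟘 ≈⟨ ≗⇒≈ (λ n → ℤP.+-identityʳ _) ⟩
      deriv a ⊛ g ∎

module ModuloPrime {p : ℕ} (prime : Prime p) where

  open ModuloP p public
  open import Data.Integer.Divisibility.Signed using (divides; ∣⇒∣ᵤ; ∣ᵤ⇒∣)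
  open import Data.Nat.Primality using (prime⇒irreducible; euclidsLemma; prime⇒nonTrivial)
  open import Data.Nat.Coprimality using (Coprime; coprime-Bézout)
  open import Data.Nat.GCD using (module Bézout)
  import Data.Nat.Divisibility as ℕ∣

  1<p : 1 < p
  1<p = ℕ.nonTrivial⇒n>1 p {{prime⇒nonTrivial prime}}

  p∤1 : ¬ p∣ 1ℤ
  p∤1 = p∤+ ℕP.≤-refl 1<p

  p∣*⇒p∣⊎p∣ : ∀ x y → p∣ (x * y) → p∣ x ⊎ p∣ y
  p∣*⇒p∣⊎p∣ x y d with euclidsLemma ℤ.∣ x ∣ ℤ.∣ y ∣ prime (subst (p ℕ∣.∣_) (ℤP.abs-* x y) (∣⇒∣ᵤ d))
  ... | inj₁ p∣x = inj₁ (∣ᵤ⇒∣ p∣x)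
  ... | inj₂ p∣y = inj₂ (∣ᵤ⇒∣ p∣y)

  p∤* : ∀ {x y} → ¬ p∣ x → ¬ p∣ y → ¬ p∣ (x * y)
  p∤* {x} {y} p∤x p∤y = [ p∤x , p∤y ]′ ∘ p∣*⇒p∣⊎p∣ x y

  p∤⇒coprime : ∀ {m} → ¬ p∣ (+ m) → Coprime p m
  p∤⇒coprime p∤m {d} (d∣p , d∣m) with prime⇒irreducible prime d∣p
  ... | inj₁ d≡1 = d≡1
  ... | inj₂ refl = ⊥-elim (p∤m (∣ᵤ⇒∣ d∣m))

  private
    cast : ∀ {b m a q} → 1 ℕ.+ b ℕ.* m ≡ a ℕ.* q → 1ℤ + + b * + m ≡ + a * + q
    cast {b} {m} {a} {q} eq = trans (cong (_+_ 1ℤ) (sym (ℤP.pos-* b m)))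
      (trans (sym (ℤP.pos-+ 1 (b ℕ.* m))) (trans (cong +_ eq) (ℤP.pos-* a q)))

  inverseℕ : ∀ m → ¬ p∣ (+ m) → ∃ λ u → p∣ (u * + m - 1ℤ)
  inverseℕ m p∤m with coprime-Bézout (p∤⇒coprime p∤m)
  ... | Bézout.+- a b eq = - + b , divides (- + a) (rearrange (+ a) (+ b) (+ m) (+ p) (cast {b} {m} {a} {p} eq))
    where
    rearrange : ∀ a b m p → 1ℤ + b * m ≡ a * p → - b * m - 1ℤ ≡ - a * p
    rearrange a b m p e = trans (negate b m) (trans (cong -_ e) (ℤP.neg-distribˡ-* a p))
      where
      negate : ∀ b m → - b * m - 1ℤ ≡ - (1ℤ + b * m)
      negate = solve-∀
  ... | Bézout.-+ a b eq = + b , divides (+ a) (trans (cong (_- 1ℤ) (sym (cast {a} {p} {b} {m} eq))) (cancel (+ a * + p)))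
    where
    cancel : ∀ x → 1ℤ + x - 1ℤ ≡ x
    cancel = solve-∀

  inverse : ∀ x → ¬ p∣ x → ∃ λ u → p∣ (u * x - 1ℤ)
  inverse (+ m) p∤x = inverseℕ m p∤x
  inverse ℤ.-[1+ m ] p∤x with inverseℕ (suc m) (p∤x ∘ ∣ᵤ⇒∣ ∘ ∣⇒∣ᵤ)
  ... | u , d = - u , subst (λ t → p∣ (t - 1ℤ)) (negate-both u (+ suc m)) d
    where
    negate-both : ∀ u m → u * m ≡ - u * - m
    negate-both = solve-∀

  const-inverse : ∀ {x} → ¬ p∣ x → ∃ λ w → const w ⊛ const x ≈ 𝟙
  const-inverse {x} p∤x with inverse x p∤x
  ... | w , d = w , ≈-trans (≈-sym (const-* w x)) (≈-trans (const-cong d) const-1)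

  Deg-⊛ : ∀ {a b da db} → Deg a da → Deg b db → Deg (a ⊛ b) (da ℕ.+ db)
  Deg-⊛ {a} {b} {da} {db} (mkDeg sa ta) (mkDeg sb tb) =
    mkDeg (proj₁ lead) λ d → p∤* ta tb (subst p∣_ (cancel ((a ⊛ b) (da ℕ.+ db)) (a da * b db)) (p∣+ d (p∣- (proj₂ lead))))
    where
    lead = ⊛-DegLt da db a b sa sb
    cancel : ∀ x y → x + - (x - y) ≡ y
    cancel = solve-∀

  Deg-^ˢ : ∀ {a d} k → Deg a d → Deg (a ^ˢ k) (k ℕ.* d)
  Deg-^ˢ zero _ = mkDeg (λ { (suc n) _ → p∣0 }) p∤1
  Deg-^ˢ (suc k) t = Deg-⊛ t (Deg-^ˢ k t)

  ⊛-cancel-𝟘 : ∀ {a d} → Deg a d → ∀ B → a ⊛ ⟦ B ⟧ ≈ 𝟘 → ⟦ B ⟧ ≈ 𝟘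
  ⊛-cancel-𝟘 ta B z with ≈𝟘-or-Deg B
  ... | inj₁ B≈𝟘 = B≈𝟘
  ... | inj₂ (_ , tB) = ⊥-elim (Deg⇒≉𝟘 (Deg-⊛ ta tB) z)

  -- The cofactor must be a polynomial: in 𝔽ₚ⟦x⟧ every C with p ∤ C(0) is a unit.
  infix 4 _∣ₚ_

  record _∣ₚ_ (C : Poly) (y : Series) : Set where
    constructor dividesₚ
    field
      cofactor : Poly
      factorisation : y ≈ ⟦ C ⟧ ⊛ ⟦ cofactor ⟧

  ∣ₚ-resp-≈ : ∀ {C y y′} → y ≈ y′ → C ∣ₚ y → C ∣ₚ y′
  ∣ₚ-resp-≈ e (dividesₚ D d) = dividesₚ D (≈-trans (≈-sym e) d)

  ∣ₚ⇒Deg≤ : ∀ {C y c a} → C ∣ₚ y → Deg ⟦ C ⟧ c → Deg y a → c ≤ a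
  ∣ₚ⇒Deg≤ {C} {c = c} (dividesₚ D y≈CD) tC ty with ≈𝟘-or-Deg D
  ... | inj₁ D≈𝟘 = ⊥-elim (Deg⇒≉𝟘 ty (≈-trans y≈CD (≈-trans (≗⇒≈ (⊛-comm ⟦ C ⟧ ⟦ D ⟧)) (⊛-zeroₚ ⟦ C ⟧ D≈𝟘))))
  ... | inj₂ (d , tD) = subst (c ≤_) (Deg-unique (Deg-resp-≈ (≈-sym y≈CD) (Deg-⊛ tC tD)) ty) (ℕP.m≤m+n c d)

  Deg<⇒∤ₚ : ∀ {C y c a} → Deg ⟦ C ⟧ c → Deg y a → a < c → ¬ C ∣ₚ y
  Deg<⇒∤ₚ tC ty a<c d = ℕP.<⇒≱ a<c (∣ₚ⇒Deg≤ d tC ty)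

  ∤ₚ-const : ∀ {C c x} → Deg ⟦ C ⟧ c → 1 ≤ c → ¬ p∣ x → ¬ C ∣ₚ const x
  ∤ₚ-const tC 1≤c p∤x = Deg<⇒∤ₚ tC (mkDeg (λ { (suc n) _ → p∣0 }) p∤x) 1≤c

  monomial : ℤ → ℕ → Poly
  monomial c zero = c ∷ []
  monomial c (suc k) = 0ℤ ∷ monomial c k

  const-⊛ : ∀ c b → const c ⊛ b ≗ c · b
  const-⊛ c b zero = refl
  const-⊛ c b (suc n) = trans (cong (_+_ (c * b (suc n))) (⊛-zeroˡ b n)) (ℤP.+-identityʳ _)

  monomial-⊛ : ∀ c k b n → k ≤ n → (⟦ monomial c k ⟧ ⊛ b) n ≡ c * b (n ∸ k)
  monomial-⊛ c zero b n _ = const-⊛ c b n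
  monomial-⊛ c (suc k) b (suc n) (s≤s le) =
    trans (cong (_+ (⟦ monomial c k ⟧ ⊛ b) n) (ℤP.*-zeroˡ (b (suc n)))) (trans (ℤP.+-identityˡ _) (monomial-⊛ c k b n le))

  no-quotient : ∀ A B → ⟦ A ⟧ ≈ ⟦ [] ⟧ ⊛ ⟦ B ⟧ ⊕ ⟦ A ⟧
  no-quotient A B = ≈-sym (≈-trans (+-congʳ ⟦ A ⟧ (≗⇒≈ (⊛-zeroˡ ⟦ B ⟧))) (≗⇒≈ λ n → ℤP.+-identityˡ _))

  -- One step of long division: subtracting (a_M / b_b) x^(M-b) B kills the coefficient of x^M.
  cancel-leading : ∀ B {b} → Deg ⟦ B ⟧ b → ∀ {M} A → b ≤ M → DegLt ⟦ A ⟧ (suc M) →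
    ∃ λ T → DegLt ⟦ subP A (mulP T B) ⟧ M
  cancel-leading B {b} (mkDeg sB tB) {M} A b≤M sA = T , lower
    where
    u = proj₁ (inverse (coeff B b) tB)
    k = M ∸ b
    T = monomial (coeff A M * u) k
    A′ = subP A (mulP T B)
    coeff-A′ : ∀ n → coeff A′ n ≡ coeff A n + - (⟦ T ⟧ ⊛ ⟦ B ⟧) n
    coeff-A′ n = trans (coeff-subP A (mulP T B) n) (cong (λ t → coeff A n + - t) (coeff-mulP T B n))
    k≤M : k ≤ M
    k≤M = ℕP.m∸n≤m M b
    lower : DegLt ⟦ A′ ⟧ M
    lower n M≤n with ℕP.m≤n⇒m<n∨m≡n M≤n
    ... | inj₂ refl = subst p∣_ (sym (trans (coeff-A′ M) (cong (λ t → coeff A M + - t)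
          (trans (monomial-⊛ _ k ⟦ B ⟧ M k≤M) (cong (λ t → (coeff A M * u) * coeff B t) (ℕP.m∸[m∸n]≡n b≤M))))))
        (subst p∣_ (expand (coeff A M) u (coeff B b)) (p∣- (p∣*ˡ (coeff A M) (proj₂ (inverse (coeff B b) tB)))))
      where
      expand : ∀ α u β → - (α * (u * β - 1ℤ)) ≡ α + - ((α * u) * β)
      expand = solve-∀
    ... | inj₁ M<n = subst p∣_ (sym (trans (coeff-A′ n) (cong (λ t → coeff A n + - t) (monomial-⊛ _ k ⟦ B ⟧ n (ℕP.≤-trans k≤M M≤n)))))
        (p∣+ (sA n M<n) (p∣- (p∣*ˡ (coeff A M * u) (sB (n ∸ k) b<n∸k))))
      where
      b<n∸k : b < n ∸ k
      b<n∸k = subst (_< n ∸ k) (ℕP.m∸[m∸n]≡n b≤M) (ℕP.∸-monoˡ-< M<n k≤M)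

  divMod : ∀ B {b} → Deg ⟦ B ⟧ b → ∀ N A → DegLt ⟦ A ⟧ N →
    ∃₂ λ Q R → (⟦ A ⟧ ≈ ⟦ Q ⟧ ⊛ ⟦ B ⟧ ⊕ ⟦ R ⟧) × DegLt ⟦ R ⟧ b
  divMod B tB zero A sA = [] , A , no-quotient A B , DegLt-mono z≤n sA
  divMod B {b} tB (suc M) A sA with b ℕP.≤? M
  ... | no M<b = [] , A , no-quotient A B , DegLt-mono (ℕP.≰⇒> M<b) sA
  ... | yes b≤M with cancel-leading B tB A b≤M sA
  ...   | T , sA′ with divMod B tB M (subP A (mulP T B)) sA′
  ...     | Q , R , A′≈QB+R , sR = addP Q T , R , A≈[Q+T]B+R , sR
    where
    A′ = subP A (mulP T B)
    A≈[Q+T]B+R : ⟦ A ⟧ ≈ ⟦ addP Q T ⟧ ⊛ ⟦ B ⟧ ⊕ ⟦ R ⟧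
    A≈[Q+T]B+R = begin
      ⟦ A ⟧
        ≈⟨ solve 2 (λ a m → a := (a :+ :- m) :+ m) ≈-refl ⟦ A ⟧ (⟦ T ⟧ ⊛ ⟦ B ⟧) ⟩
      (⟦ A ⟧ ⊕ ⊝ (⟦ T ⟧ ⊛ ⟦ B ⟧)) ⊕ ⟦ T ⟧ ⊛ ⟦ B ⟧
        ≈⟨ +-congʳ (⟦ T ⟧ ⊛ ⟦ B ⟧) (≈-sym (≈-trans (≗⇒≈ (coeff-subP A (mulP T B))) (+-congˡ ⟦ A ⟧ (⊝-cong (≗⇒≈ (coeff-mulP T B)))))) ⟩
      ⟦ A′ ⟧ ⊕ ⟦ T ⟧ ⊛ ⟦ B ⟧
        ≈⟨ +-congʳ (⟦ T ⟧ ⊛ ⟦ B ⟧) A′≈QB+R ⟩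
      (⟦ Q ⟧ ⊛ ⟦ B ⟧ ⊕ ⟦ R ⟧) ⊕ ⟦ T ⟧ ⊛ ⟦ B ⟧
        ≈⟨ solve 4 (λ q b r t → (q :* b :+ r) :+ t :* b := (q :+ t) :* b :+ r) ≈-refl ⟦ Q ⟧ ⟦ B ⟧ ⟦ R ⟧ ⟦ T ⟧ ⟩
      (⟦ Q ⟧ ⊕ ⟦ T ⟧) ⊛ ⟦ B ⟧ ⊕ ⟦ R ⟧
        ≈⟨ +-congʳ ⟦ R ⟧ (*-congʳ ⟦ B ⟧ (≈-sym (≗⇒≈ (coeff-addP Q T)))) ⟩
      ⟦ addP Q T ⟧ ⊛ ⟦ B ⟧ ⊕ ⟦ R ⟧ ∎

  record BézoutGcd (C X : Poly) : Set where
    constructor bézoutGcd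
    field
      G U V : Poly
      identity : ⟦ G ⟧ ≈ ⟦ U ⟧ ⊛ ⟦ C ⟧ ⊕ ⟦ V ⟧ ⊛ ⟦ X ⟧
      G∣C : G ∣ₚ ⟦ C ⟧
      G∣X : G ∣ₚ ⟦ X ⟧

  BézoutGcd-zero : ∀ C X → ⟦ X ⟧ ≈ 𝟘 → BézoutGcd C X
  BézoutGcd-zero C X X≈𝟘 = bézoutGcd C (1ℤ ∷ []) []
    (≈-trans (solve 2 (λ c x → c := con 1ℤ :* c :+ con 0ℤ :* x) ≈-refl ⟦ C ⟧ ⟦ X ⟧)
             (+-congˡ (const 1ℤ ⊛ ⟦ C ⟧) (*-congʳ ⟦ X ⟧ const-0)))
    (dividesₚ (1ℤ ∷ []) (solve 1 (λ c → c := c :* con 1ℤ) ≈-refl ⟦ C ⟧))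
    (dividesₚ [] (≈-trans X≈𝟘 (≈-sym (≈-trans (*-congˡ ⟦ C ⟧ (≈-sym const-0))
      (≈-trans (solve 1 (λ c → c :* con 0ℤ := con 0ℤ) ≈-refl ⟦ C ⟧) const-0)))))

  BézoutGcd-step : ∀ C X Q R → ⟦ C ⟧ ≈ ⟦ Q ⟧ ⊛ ⟦ X ⟧ ⊕ ⟦ R ⟧ → BézoutGcd X R → BézoutGcd C X
  BézoutGcd-step C X Q R C≈QX+R (bézoutGcd G U V G≈UX+VR (dividesₚ D₁ X≈GD₁) (dividesₚ D₂ R≈GD₂)) =
    bézoutGcd G V (subP U (mulP V Q)) identity (dividesₚ (addP (mulP Q D₁) D₂) C≈G[QD₁+D₂]) (dividesₚ D₁ X≈GD₁)
    where
    identity : ⟦ G ⟧ ≈ ⟦ V ⟧ ⊛ ⟦ C ⟧ ⊕ ⟦ subP U (mulP V Q) ⟧ ⊛ ⟦ X ⟧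
    identity = begin
      ⟦ G ⟧ ≈⟨ G≈UX+VR ⟩
      ⟦ U ⟧ ⊛ ⟦ X ⟧ ⊕ ⟦ V ⟧ ⊛ ⟦ R ⟧
        ≈⟨ +-congˡ (⟦ U ⟧ ⊛ ⟦ X ⟧) (*-congˡ ⟦ V ⟧ (≈-trans
             (solve 3 (λ q x r → r := (q :* x :+ r) :+ :- (q :* x)) ≈-refl ⟦ Q ⟧ ⟦ X ⟧ ⟦ R ⟧)
             (+-congʳ (⊝ (⟦ Q ⟧ ⊛ ⟦ X ⟧)) (≈-sym C≈QX+R)))) ⟩
      ⟦ U ⟧ ⊛ ⟦ X ⟧ ⊕ ⟦ V ⟧ ⊛ (⟦ C ⟧ ⊕ ⊝ (⟦ Q ⟧ ⊛ ⟦ X ⟧))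
        ≈⟨ solve 5 (λ u x v c q → u :* x :+ v :* (c :+ :- (q :* x)) := v :* c :+ (u :+ :- (v :* q)) :* x) ≈-refl
             ⟦ U ⟧ ⟦ X ⟧ ⟦ V ⟧ ⟦ C ⟧ ⟦ Q ⟧ ⟩
      ⟦ V ⟧ ⊛ ⟦ C ⟧ ⊕ (⟦ U ⟧ ⊕ ⊝ (⟦ V ⟧ ⊛ ⟦ Q ⟧)) ⊛ ⟦ X ⟧
        ≈⟨ +-congˡ (⟦ V ⟧ ⊛ ⟦ C ⟧) (*-congʳ ⟦ X ⟧ (≈-sym
             (≈-trans (≗⇒≈ (coeff-subP U (mulP V Q))) (+-congˡ ⟦ U ⟧ (⊝-cong (≗⇒≈ (coeff-mulP V Q))))))) ⟩
      ⟦ V ⟧ ⊛ ⟦ C ⟧ ⊕ ⟦ subP U (mulP V Q) ⟧ ⊛ ⟦ X ⟧ ∎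
    C≈G[QD₁+D₂] : ⟦ C ⟧ ≈ ⟦ G ⟧ ⊛ ⟦ addP (mulP Q D₁) D₂ ⟧
    C≈G[QD₁+D₂] = begin
      ⟦ C ⟧ ≈⟨ C≈QX+R ⟩
      ⟦ Q ⟧ ⊛ ⟦ X ⟧ ⊕ ⟦ R ⟧ ≈⟨ ⊕-cong (*-congˡ ⟦ Q ⟧ X≈GD₁) R≈GD₂ ⟩
      ⟦ Q ⟧ ⊛ (⟦ G ⟧ ⊛ ⟦ D₁ ⟧) ⊕ ⟦ G ⟧ ⊛ ⟦ D₂ ⟧
        ≈⟨ solve 4 (λ q g d₁ d₂ → q :* (g :* d₁) :+ g :* d₂ := g :* (q :* d₁ :+ d₂)) ≈-refl ⟦ Q ⟧ ⟦ G ⟧ ⟦ D₁ ⟧ ⟦ D₂ ⟧ ⟩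
      ⟦ G ⟧ ⊛ (⟦ Q ⟧ ⊛ ⟦ D₁ ⟧ ⊕ ⟦ D₂ ⟧)
        ≈⟨ *-congˡ ⟦ G ⟧ (≈-sym (≗⇒≈ λ n → trans (coeff-addP (mulP Q D₁) D₂ n) (cong (_+ coeff D₂ n) (coeff-mulP Q D₁ n)))) ⟩
      ⟦ G ⟧ ⊛ ⟦ addP (mulP Q D₁) D₂ ⟧ ∎

  euclid : ∀ N C X → DegLt ⟦ X ⟧ N → BézoutGcd C X
  euclid N C X sX with ≈𝟘-or-Deg X
  ... | inj₁ X≈𝟘 = BézoutGcd-zero C X X≈𝟘
  euclid zero C X sX | inj₂ (_ , tX) = ⊥-elim (Deg⇒≉𝟘 tX (p∣⇒≈𝟘 λ n → sX n z≤n))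
  euclid (suc M) C X sX | inj₂ (x , tX) with divMod X tX (length C) C (DegLt-length C)
  ... | Q , R , C≈QX+R , sR =
    BézoutGcd-step C X Q R C≈QX+R (euclid M X R (DegLt-mono (ℕP.≤-pred (Deg⇒< tX sX)) sR))

  EqMod⇒≈ : ∀ A B → EqMod p A B → ⟦ A ⟧ ≈ ⟦ B ⟧
  EqMod⇒≈ A B e = mk≈ λ n → ∣ᵤ⇒∣ (e n)

  ≈⇒EqMod : ∀ A B → ⟦ A ⟧ ≈ ⟦ B ⟧ → EqMod p A B
  ≈⇒EqMod A B e n = ∣⇒∣ᵤ (p∣coeff-diff e n)

  DividesMod⇔∣ₚ : ∀ C A → (DividesMod p C A → C ∣ₚ ⟦ A ⟧) × (C ∣ₚ ⟦ A ⟧ → DividesMod p C A)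
  DividesMod⇔∣ₚ C A =
    (λ { (D , A≡CD) → dividesₚ D (≈-trans (EqMod⇒≈ A (mulP C D) A≡CD) (≗⇒≈ (coeff-mulP C D))) }) ,
    (λ { (dividesₚ D A≈CD) → D , ≈⇒EqMod A (mulP C D) (≈-trans A≈CD (≈-sym (≗⇒≈ (coeff-mulP C D)))) })

  UnitMod⇒≈const : ∀ D → UnitMod p D → ⟦ D ⟧ ≈ const (coeff D 0) × ¬ p∣ coeff D 0
  UnitMod⇒≈const D (const-D , p∤D₀) =
    mk≈ (λ { zero → p∣x-x (coeff D 0)
           ; (suc n) → subst p∣_ (sym (ℤP.+-identityʳ (coeff D (suc n)))) (∣ᵤ⇒∣ (const-D (suc n) (s≤s z≤n))) })
    , p∤D₀ ∘ ∣⇒∣ᵤ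

  ∣ₚ-via-unit-cofactor : ∀ C X G D E → ⟦ C ⟧ ≈ ⟦ G ⟧ ⊛ ⟦ D ⟧ → ⟦ X ⟧ ≈ ⟦ G ⟧ ⊛ ⟦ E ⟧ → UnitMod p D → C ∣ₚ ⟦ X ⟧
  ∣ₚ-via-unit-cofactor C X G D E C≈GD X≈GE unit-D = dividesₚ (mulP (w ∷ []) E) (begin
    ⟦ X ⟧ ≈⟨ X≈GE ⟩
    ⟦ G ⟧ ⊛ ⟦ E ⟧
      ≈⟨ *-congˡ ⟦ G ⟧ (≈-trans (≈-sym (≗⇒≈ (⊛-identityˡ ⟦ E ⟧))) (*-congʳ ⟦ E ⟧ (≈-sym dw≈𝟙))) ⟩
    ⟦ G ⟧ ⊛ ((const d ⊛ const w) ⊛ ⟦ E ⟧) ≈⟨ reassociate ⟦ G ⟧ (const d) (const w) ⟦ E ⟧ ⟩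
    (⟦ G ⟧ ⊛ const d) ⊛ (const w ⊛ ⟦ E ⟧)
      ≈⟨ ⊛-cong (≈-trans (*-congˡ ⟦ G ⟧ (≈-sym (proj₁ D≈d))) (≈-sym C≈GD)) (≈-sym (≗⇒≈ (coeff-mulP (w ∷ []) E))) ⟩
    ⟦ C ⟧ ⊛ ⟦ mulP (w ∷ []) E ⟧ ∎)
    where
    D≈d = UnitMod⇒≈const D unit-D
    d = coeff D 0
    w = proj₁ (const-inverse (proj₂ D≈d))
    dw≈𝟙 : const d ⊛ const w ≈ 𝟙
    dw≈𝟙 = ≈-trans (≗⇒≈ (⊛-comm (const d) (const w))) (proj₂ (const-inverse (proj₂ D≈d)))
    reassociate : ∀ g d w e → g ⊛ ((d ⊛ w) ⊛ e) ≈ (g ⊛ d) ⊛ (w ⊛ e)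
    reassociate = solve 4 (λ g d w e → g :* ((d :* w) :* e) := (g :* d) :* (w :* e)) ≈-refl

  unit-combination⇒coprime : ∀ C X G U V → ⟦ G ⟧ ≈ ⟦ U ⟧ ⊛ ⟦ C ⟧ ⊕ ⟦ V ⟧ ⊛ ⟦ X ⟧ → UnitMod p G →
    ∃₂ λ U′ V′ → ⟦ U′ ⟧ ⊛ ⟦ C ⟧ ⊕ ⟦ V′ ⟧ ⊛ ⟦ X ⟧ ≈ 𝟙
  unit-combination⇒coprime C X G U V G≈UC+VX unit-G = mulP (w ∷ []) U , mulP (w ∷ []) V , ≈-sym (begin
    𝟙 ≈⟨ ≈-sym (proj₂ (const-inverse (proj₂ G≈g))) ⟩
    const w ⊛ const (coeff G 0) ≈⟨ *-congˡ (const w) (≈-trans (≈-sym (proj₁ G≈g)) G≈UC+VX) ⟩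
    const w ⊛ (⟦ U ⟧ ⊛ ⟦ C ⟧ ⊕ ⟦ V ⟧ ⊛ ⟦ X ⟧) ≈⟨ distribute (const w) ⟦ U ⟧ ⟦ C ⟧ ⟦ V ⟧ ⟦ X ⟧ ⟩
    (const w ⊛ ⟦ U ⟧) ⊛ ⟦ C ⟧ ⊕ (const w ⊛ ⟦ V ⟧) ⊛ ⟦ X ⟧
      ≈⟨ ⊕-cong (*-congʳ ⟦ C ⟧ (≈-sym (≗⇒≈ (coeff-mulP (w ∷ []) U)))) (*-congʳ ⟦ X ⟧ (≈-sym (≗⇒≈ (coeff-mulP (w ∷ []) V)))) ⟩
    ⟦ mulP (w ∷ []) U ⟧ ⊛ ⟦ C ⟧ ⊕ ⟦ mulP (w ∷ []) V ⟧ ⊛ ⟦ X ⟧ ∎)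
    where
    G≈g = UnitMod⇒≈const G unit-G
    w = proj₁ (const-inverse (proj₂ G≈g))
    distribute : ∀ w u c v x → w ⊛ (u ⊛ c ⊕ v ⊛ x) ≈ (w ⊛ u) ⊛ c ⊕ (w ⊛ v) ⊛ x
    distribute = solve 5 (λ w u c v x → w :* (u :* c :+ v :* x) := (w :* u) :* c :+ (w :* v) :* x) ≈-refl

  irreducible-∤ₚ⇒coprime : ∀ C X → IrreducibleMod p C → ¬ C ∣ₚ ⟦ X ⟧ →
    ∃₂ λ U V → ⟦ U ⟧ ⊛ ⟦ C ⟧ ⊕ ⟦ V ⟧ ⊛ ⟦ X ⟧ ≈ 𝟙
  irreducible-∤ₚ⇒coprime C X (_ , irreducible) C∤X = from-gcd (euclid (length X) C X (DegLt-length X))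
    where
    from-gcd : BézoutGcd C X → ∃₂ λ U V → ⟦ U ⟧ ⊛ ⟦ C ⟧ ⊕ ⟦ V ⟧ ⊛ ⟦ X ⟧ ≈ 𝟙
    from-gcd (bézoutGcd G U V G≈UC+VX (dividesₚ D C≈GD) (dividesₚ E X≈GE)) =
      [ unit-combination⇒coprime C X G U V G≈UC+VX
      , (λ unit-D → ⊥-elim (C∤X (∣ₚ-via-unit-cofactor C X G D E C≈GD X≈GE unit-D)))
      ]′ (irreducible G D (≈⇒EqMod C (mulP G D) (≈-trans C≈GD (≈-sym (≗⇒≈ (coeff-mulP G D))))))

  coprime-∣ₚ-⊛ : ∀ C Y Z U V → ⟦ U ⟧ ⊛ ⟦ C ⟧ ⊕ ⟦ V ⟧ ⊛ ⟦ Y ⟧ ≈ 𝟙 → C ∣ₚ ⟦ Y ⟧ ⊛ ⟦ Z ⟧ → C ∣ₚ ⟦ Z ⟧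
  coprime-∣ₚ-⊛ C Y Z U V UC+VY≈𝟙 (dividesₚ W YZ≈CW) = dividesₚ (addP (mulP Z U) (mulP V W)) (begin
    ⟦ Z ⟧ ≈⟨ ≈-sym (≗⇒≈ λ n → trans (⊛-comm ⟦ Z ⟧ 𝟙 n) (⊛-identityˡ ⟦ Z ⟧ n)) ⟩
    ⟦ Z ⟧ ⊛ 𝟙 ≈⟨ *-congˡ ⟦ Z ⟧ (≈-sym UC+VY≈𝟙) ⟩
    ⟦ Z ⟧ ⊛ (⟦ U ⟧ ⊛ ⟦ C ⟧ ⊕ ⟦ V ⟧ ⊛ ⟦ Y ⟧) ≈⟨ expand ⟦ Z ⟧ ⟦ U ⟧ ⟦ C ⟧ ⟦ V ⟧ ⟦ Y ⟧ ⟩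
    ⟦ C ⟧ ⊛ (⟦ Z ⟧ ⊛ ⟦ U ⟧) ⊕ ⟦ V ⟧ ⊛ (⟦ Y ⟧ ⊛ ⟦ Z ⟧) ≈⟨ +-congˡ (⟦ C ⟧ ⊛ (⟦ Z ⟧ ⊛ ⟦ U ⟧)) (*-congˡ ⟦ V ⟧ YZ≈CW) ⟩
    ⟦ C ⟧ ⊛ (⟦ Z ⟧ ⊛ ⟦ U ⟧) ⊕ ⟦ V ⟧ ⊛ (⟦ C ⟧ ⊛ ⟦ W ⟧) ≈⟨ factor ⟦ C ⟧ ⟦ Z ⟧ ⟦ U ⟧ ⟦ V ⟧ ⟦ W ⟧ ⟩
    ⟦ C ⟧ ⊛ (⟦ Z ⟧ ⊛ ⟦ U ⟧ ⊕ ⟦ V ⟧ ⊛ ⟦ W ⟧)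
      ≈⟨ *-congˡ ⟦ C ⟧ (≈-sym (≗⇒≈ λ n → trans (coeff-addP (mulP Z U) (mulP V W) n) (cong₂ _+_ (coeff-mulP Z U n) (coeff-mulP V W n)))) ⟩
    ⟦ C ⟧ ⊛ ⟦ addP (mulP Z U) (mulP V W) ⟧ ∎)
    where
    expand : ∀ z u c v y → z ⊛ (u ⊛ c ⊕ v ⊛ y) ≈ c ⊛ (z ⊛ u) ⊕ v ⊛ (y ⊛ z)
    expand = solve 5 (λ z u c v y → z :* (u :* c :+ v :* y) := c :* (z :* u) :+ v :* (y :* z)) ≈-refl
    factor : ∀ c z u v w → c ⊛ (z ⊛ u) ⊕ v ⊛ (c ⊛ w) ≈ c ⊛ (z ⊛ u ⊕ v ⊛ w)
    factor = solve 5 (λ c z u v w → c :* (z :* u) :+ v :* (c :* w) := c :* (z :* u :+ v :* w)) ≈-refl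

  irreducible-∣ₚ-⊛ : ∀ {C} Y Z → IrreducibleMod p C → C ∣ₚ ⟦ Y ⟧ ⊛ ⟦ Z ⟧ → ¬ C ∣ₚ ⟦ Y ⟧ → C ∣ₚ ⟦ Z ⟧
  irreducible-∣ₚ-⊛ {C} Y Z irr C∣YZ C∤Y =
    let U , V , UC+VY≈𝟙 = irreducible-∤ₚ⇒coprime C Y irr C∤Y in coprime-∣ₚ-⊛ C Y Z U V UC+VY≈𝟙 C∣YZ

  irreducible-∤ₚ-⊛ : ∀ {C} Y Z → IrreducibleMod p C → ¬ C ∣ₚ ⟦ Y ⟧ → ¬ C ∣ₚ ⟦ Z ⟧ → ¬ C ∣ₚ ⟦ Y ⟧ ⊛ ⟦ Z ⟧
  irreducible-∤ₚ-⊛ Y Z irr C∤Y C∤Z C∣YZ = C∤Z (irreducible-∣ₚ-⊛ Y Z irr C∣YZ C∤Y)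

  remainder-≈𝟘⇒∣ₚ : ∀ C Y Q R → ⟦ Y ⟧ ≈ ⟦ Q ⟧ ⊛ ⟦ C ⟧ ⊕ ⟦ R ⟧ → ⟦ R ⟧ ≈ 𝟘 → C ∣ₚ ⟦ Y ⟧
  remainder-≈𝟘⇒∣ₚ C Y Q R Y≈QC+R R≈𝟘 = dividesₚ Q (begin
    ⟦ Y ⟧ ≈⟨ Y≈QC+R ⟩
    ⟦ Q ⟧ ⊛ ⟦ C ⟧ ⊕ ⟦ R ⟧ ≈⟨ +-congˡ (⟦ Q ⟧ ⊛ ⟦ C ⟧) (≈-trans R≈𝟘 (≈-sym const-0)) ⟩
    ⟦ Q ⟧ ⊛ ⟦ C ⟧ ⊕ const 0ℤ ≈⟨ commute ⟦ Q ⟧ ⟦ C ⟧ ⟩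
    ⟦ C ⟧ ⊛ ⟦ Q ⟧ ∎)
    where
    commute : ∀ q c → q ⊛ c ⊕ const 0ℤ ≈ c ⊛ q
    commute = solve 2 (λ q c → q :* c :+ con 0ℤ := c :* q) ≈-refl

  ∣ₚ⇒∣ₚ-remainder : ∀ C Y Q R → ⟦ Y ⟧ ≈ ⟦ Q ⟧ ⊛ ⟦ C ⟧ ⊕ ⟦ R ⟧ → C ∣ₚ ⟦ Y ⟧ → C ∣ₚ ⟦ R ⟧
  ∣ₚ⇒∣ₚ-remainder C Y Q R Y≈QC+R (dividesₚ E Y≈CE) = dividesₚ (subP E Q) (begin
    ⟦ R ⟧ ≈⟨ isolate ⟦ Q ⟧ ⟦ C ⟧ ⟦ R ⟧ ⟩
    (⟦ Q ⟧ ⊛ ⟦ C ⟧ ⊕ ⟦ R ⟧) ⊕ ⊝ (⟦ Q ⟧ ⊛ ⟦ C ⟧) ≈⟨ +-congʳ (⊝ (⟦ Q ⟧ ⊛ ⟦ C ⟧)) (≈-trans (≈-sym Y≈QC+R) Y≈CE) ⟩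
    ⟦ C ⟧ ⊛ ⟦ E ⟧ ⊕ ⊝ (⟦ Q ⟧ ⊛ ⟦ C ⟧) ≈⟨ factor ⟦ C ⟧ ⟦ E ⟧ ⟦ Q ⟧ ⟩
    ⟦ C ⟧ ⊛ (⟦ E ⟧ ⊕ ⊝ ⟦ Q ⟧) ≈⟨ *-congˡ ⟦ C ⟧ (≈-sym (≗⇒≈ (coeff-subP E Q))) ⟩
    ⟦ C ⟧ ⊛ ⟦ subP E Q ⟧ ∎)
    where
    isolate : ∀ q c r → r ≈ (q ⊛ c ⊕ r) ⊕ ⊝ (q ⊛ c)
    isolate = solve 3 (λ q c r → r := (q :* c :+ r) :+ :- (q :* c)) ≈-refl
    factor : ∀ c e q → c ⊛ e ⊕ ⊝ (q ⊛ c) ≈ c ⊛ (e ⊕ ⊝ q)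
    factor = solve 3 (λ c e q → c :* e :+ :- (q :* c) := c :* (e :+ :- q)) ≈-refl

  ∣ₚ? : ∀ C {c} → Deg ⟦ C ⟧ c → ∀ Y → Dec (C ∣ₚ ⟦ Y ⟧)
  ∣ₚ? C tC Y = let Q , R , Y≈QC+R , sR = divMod C tC (length Y) Y (DegLt-length Y) in
    [ (λ R≈𝟘 → yes (remainder-≈𝟘⇒∣ₚ C Y Q R Y≈QC+R R≈𝟘))
    , (λ { (_ , tR) → no (Deg<⇒∤ₚ tC tR (Deg⇒< tR sR) ∘ ∣ₚ⇒∣ₚ-remainder C Y Q R Y≈QC+R) })
    ]′ (≈𝟘-or-Deg R)

  ^ˢ-cancelˡ : ∀ C {c} → Deg ⟦ C ⟧ c → ∀ k X Y → ⟦ C ⟧ ^ˢ k ⊛ ⟦ X ⟧ ≈ ⟦ C ⟧ ^ˢ k ⊛ ⟦ Y ⟧ → ⟦ X ⟧ ≈ ⟦ Y ⟧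
  ^ˢ-cancelˡ C tC k X Y CᵏX≈CᵏY = begin
    ⟦ X ⟧ ≈⟨ solve 2 (λ x y → x := (x :+ :- y) :+ y) ≈-refl ⟦ X ⟧ ⟦ Y ⟧ ⟩
    (⟦ X ⟧ ⊕ ⊝ ⟦ Y ⟧) ⊕ ⟦ Y ⟧ ≈⟨ +-congʳ ⟦ Y ⟧ (≈-trans (≈-sym (≗⇒≈ (coeff-subP X Y))) X-Y≈𝟘) ⟩
    𝟘 ⊕ ⟦ Y ⟧ ≈⟨ ≗⇒≈ (λ n → ℤP.+-identityˡ (coeff Y n)) ⟩
    ⟦ Y ⟧ ∎
    where
    X-Y≈𝟘 : ⟦ subP X Y ⟧ ≈ 𝟘
    X-Y≈𝟘 = ⊛-cancel-𝟘 (Deg-^ˢ k tC) (subP X Y) (begin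
      ⟦ C ⟧ ^ˢ k ⊛ ⟦ subP X Y ⟧ ≈⟨ *-congˡ (⟦ C ⟧ ^ˢ k) (≗⇒≈ (coeff-subP X Y)) ⟩
      ⟦ C ⟧ ^ˢ k ⊛ (⟦ X ⟧ ⊕ ⊝ ⟦ Y ⟧)
        ≈⟨ solve 3 (λ c x y → c :* (x :+ :- y) := c :* x :+ :- (c :* y)) ≈-refl (⟦ C ⟧ ^ˢ k) ⟦ X ⟧ ⟦ Y ⟧ ⟩
      ⟦ C ⟧ ^ˢ k ⊛ ⟦ X ⟧ ⊕ ⊝ (⟦ C ⟧ ^ˢ k ⊛ ⟦ Y ⟧) ≈⟨ +-congʳ (⊝ (⟦ C ⟧ ^ˢ k ⊛ ⟦ Y ⟧)) CᵏX≈CᵏY ⟩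
      ⟦ C ⟧ ^ˢ k ⊛ ⟦ Y ⟧ ⊕ ⊝ (⟦ C ⟧ ^ˢ k ⊛ ⟦ Y ⟧) ≈⟨ ≗⇒≈ (λ n → ℤP.+-inverseʳ ((⟦ C ⟧ ^ˢ k ⊛ ⟦ Y ⟧) n)) ⟩
      𝟘 ∎)

  irreducible⇒Deg : ∀ C → IrreducibleMod p C → ∃ λ c → Deg ⟦ C ⟧ c × 1 ≤ c
  irreducible⇒Deg C (nonconstant , _) = [ (λ C≈𝟘 → ⊥-elim (nonconstant (λ n _ → ∣⇒∣ᵤ (≈𝟘⇒p∣ C≈𝟘 n))))
                                        , positive ]′ (≈𝟘-or-Deg C)
    where
    positive : ∃ (Deg ⟦ C ⟧) → ∃ λ c → Deg ⟦ C ⟧ c × 1 ≤ c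
    positive (zero , mkDeg higher _) = ⊥-elim (nonconstant (λ n 1≤n → ∣⇒∣ᵤ (higher n 1≤n)))
    positive (suc c , tC) = suc c , tC , s≤s z≤n

  cofactor-Deg : ∀ {C c A a} D → Deg ⟦ C ⟧ c → Deg ⟦ A ⟧ a → ⟦ A ⟧ ≈ ⟦ C ⟧ ⊛ ⟦ D ⟧ → ∃ λ d → Deg ⟦ D ⟧ d × c ℕ.+ d ≡ a
  cofactor-Deg {C} D tC tA A≈CD =
    [ (λ D≈𝟘 → ⊥-elim (Deg⇒≉𝟘 tA (≈-trans A≈CD (≈-trans (≗⇒≈ (⊛-comm ⟦ C ⟧ ⟦ D ⟧)) (⊛-zeroₚ ⟦ C ⟧ D≈𝟘)))))
    , (λ { (d , tD) → d , tD , Deg-unique (Deg-resp-≈ (≈-sym A≈CD) (Deg-⊛ tC tD)) tA })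
    ]′ (≈𝟘-or-Deg D)

  multiplicity : ∀ C {c} → Deg ⟦ C ⟧ c → 1 ≤ c → ∀ A {a} → Deg ⟦ A ⟧ a →
    ∃₂ λ k B → (⟦ A ⟧ ≈ ⟦ C ⟧ ^ˢ k ⊛ ⟦ B ⟧) × ¬ C ∣ₚ ⟦ B ⟧ × k ℕ.* c ≤ a
  multiplicity C {c} tC 1≤c A {a} tA = bounded (suc a) A tA ℕP.≤-refl
    where
    bounded : ∀ N A {a} → Deg ⟦ A ⟧ a → a < N → ∃₂ λ k B → (⟦ A ⟧ ≈ ⟦ C ⟧ ^ˢ k ⊛ ⟦ B ⟧) × ¬ C ∣ₚ ⟦ B ⟧ × k ℕ.* c ≤ a
    bounded (suc N) A {a} tA a<N = split (∣ₚ? C tC A)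
      where
      split : Dec (C ∣ₚ ⟦ A ⟧) → ∃₂ λ k B → (⟦ A ⟧ ≈ ⟦ C ⟧ ^ˢ k ⊛ ⟦ B ⟧) × ¬ C ∣ₚ ⟦ B ⟧ × k ℕ.* c ≤ a
      split (no C∤A) = 0 , A , ≈-sym (≗⇒≈ (⊛-identityˡ ⟦ A ⟧)) , C∤A , z≤n
      split (yes (dividesₚ D A≈CD)) =
        let d , tD , c+d≡a = cofactor-Deg {C} {A = A} D tC tA A≈CD
            d<N = ℕP.<-≤-trans (ℕP.<-≤-trans (ℕP.n<1+n d) (ℕP.+-monoˡ-≤ d 1≤c)) (ℕP.≤-pred (subst (_< suc N) (sym c+d≡a) a<N))
            k , B , D≈CᵏB , C∤B , kc≤d = bounded N D tD d<N
        in suc k , B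
         , ≈-trans A≈CD (≈-trans (*-congˡ ⟦ C ⟧ D≈CᵏB) (≗⇒≈ λ n → sym (⊛-assoc ⟦ C ⟧ (⟦ C ⟧ ^ˢ k) ⟦ B ⟧ n)))
         , C∤B , subst (suc k ℕ.* c ≤_) c+d≡a (ℕP.+-monoʳ-≤ c kc≤d)

  Deg-derivP : ∀ C {c} → Deg ⟦ C ⟧ (suc c) → suc c < p → Deg ⟦ derivP C ⟧ c
  Deg-derivP C {c} (mkDeg sC tC) c<p = Deg-resp-≈ (≈-sym (≗⇒≈ (coeff-derivP C)))
    (mkDeg (λ n c<n → p∣*ˡ (+ suc n) (sC (suc n) (s≤s c<n))) (p∤* (p∤+ (s≤s z≤n) c<p) tC))

  ∤ₚ-derivP : ∀ C {c} → Deg ⟦ C ⟧ c → 1 ≤ c → c < p → ¬ C ∣ₚ ⟦ derivP C ⟧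
  ∤ₚ-derivP C {suc c} tC _ c<p = Deg<⇒∤ₚ tC (Deg-derivP C tC c<p) ℕP.≤-refl

  ^ˢ-∣ₚ⇒≤ : ∀ {C c} → Deg ⟦ C ⟧ c → ∀ {A} k B → ⟦ A ⟧ ≈ ⟦ C ⟧ ^ˢ k ⊛ ⟦ B ⟧ → ¬ C ∣ₚ ⟦ B ⟧ →
    ∀ m → powP C m ∣ₚ ⟦ A ⟧ → m ≤ k
  ^ˢ-∣ₚ⇒≤ {C} tC {A} k B A≈CᵏB C∤B m (dividesₚ D A≈CᵐD) with m ℕP.≤? k
  ... | yes m≤k = m≤k
  ... | no m≰k = ⊥-elim (C∤B (dividesₚ (mulP (powP C r) D) B≈C[CʳD]))
    where
    r = m ∸ suc k
    m≡k+1+r : m ≡ k ℕ.+ suc r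
    m≡k+1+r = sym (trans (ℕP.+-suc k r) (ℕP.m+[n∸m]≡n (ℕP.≰⇒> m≰k)))
    ⟦C[CʳD]⟧ : ⟦ mulP C (mulP (powP C r) D) ⟧ ≈ ⟦ C ⟧ ⊛ (⟦ C ⟧ ^ˢ r ⊛ ⟦ D ⟧)
    ⟦C[CʳD]⟧ = ≗⇒≈ λ n → trans (coeff-mulP C _ n)
      (⊛-congˡ ⟦ C ⟧ (λ i → trans (coeff-mulP (powP C r) D i) (⊛-congʳ ⟦ D ⟧ (coeff-powP C r) i)) n)
    B≈C[CʳD] : ⟦ B ⟧ ≈ ⟦ C ⟧ ⊛ ⟦ mulP (powP C r) D ⟧
    B≈C[CʳD] = ≈-trans (^ˢ-cancelˡ C tC k B (mulP C (mulP (powP C r) D)) (begin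
      ⟦ C ⟧ ^ˢ k ⊛ ⟦ B ⟧ ≈⟨ ≈-trans (≈-sym A≈CᵏB) A≈CᵐD ⟩
      ⟦ powP C m ⟧ ⊛ ⟦ D ⟧ ≈⟨ *-congʳ ⟦ D ⟧ (≗⇒≈ (coeff-powP C m)) ⟩
      ⟦ C ⟧ ^ˢ m ⊛ ⟦ D ⟧ ≡⟨ cong (λ e → ⟦ C ⟧ ^ˢ e ⊛ ⟦ D ⟧) m≡k+1+r ⟩
      ⟦ C ⟧ ^ˢ (k ℕ.+ suc r) ⊛ ⟦ D ⟧ ≈⟨ *-congʳ ⟦ D ⟧ (^ˢ-+ ⟦ C ⟧ k (suc r)) ⟩
      (⟦ C ⟧ ^ˢ k ⊛ (⟦ C ⟧ ⊛ ⟦ C ⟧ ^ˢ r)) ⊛ ⟦ D ⟧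
        ≈⟨ ≗⇒≈ (λ n → trans (⊛-assoc (⟦ C ⟧ ^ˢ k) _ ⟦ D ⟧ n) (⊛-congˡ (⟦ C ⟧ ^ˢ k) (⊛-assoc ⟦ C ⟧ (⟦ C ⟧ ^ˢ r) ⟦ D ⟧) n)) ⟩
      ⟦ C ⟧ ^ˢ k ⊛ (⟦ C ⟧ ⊛ (⟦ C ⟧ ^ˢ r ⊛ ⟦ D ⟧)) ≈⟨ *-congˡ (⟦ C ⟧ ^ˢ k) (≈-sym ⟦C[CʳD]⟧) ⟩
      ⟦ C ⟧ ^ˢ k ⊛ ⟦ mulP C (mulP (powP C r) D) ⟧ ∎))
      (≗⇒≈ (coeff-mulP C (mulP (powP C r) D)))

module CAdic {p : ℕ} (prime : Prime p) (C : Poly) where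

  open ModuloPrime prime

  ⟦mulP⟧ : ∀ A B → ⟦ mulP A B ⟧ ≈ ⟦ A ⟧ ⊛ ⟦ B ⟧
  ⟦mulP⟧ A B = ≗⇒≈ (coeff-mulP A B)

  ⟦addP⟧ : ∀ A B → ⟦ addP A B ⟧ ≈ ⟦ A ⟧ ⊕ ⟦ B ⟧
  ⟦addP⟧ A B = ≗⇒≈ (coeff-addP A B)

  HasLeadingTerm : Series → ℕ → Poly → Set
  HasLeadingTerm Y j U = ∃ λ R → Y ≈ ⟦ C ⟧ ^ˢ j ⊛ (⟦ U ⟧ ⊕ ⟦ C ⟧ ⊛ ⟦ R ⟧)

  factorisation⇒HasLeadingTerm : ∀ Y j U → Y ≈ ⟦ C ⟧ ^ˢ j ⊛ ⟦ U ⟧ → HasLeadingTerm Y j U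
  factorisation⇒HasLeadingTerm Y j U Y≈CʲU = [] , ≈-trans Y≈CʲU (*-congˡ (⟦ C ⟧ ^ˢ j) (≈-sym (begin
    ⟦ U ⟧ ⊕ ⟦ C ⟧ ⊛ 𝟘 ≈⟨ +-congˡ ⟦ U ⟧ (≗⇒≈ λ n → trans (⊛-comm ⟦ C ⟧ 𝟘 n) (⊛-zeroˡ ⟦ C ⟧ n)) ⟩
    ⟦ U ⟧ ⊕ 𝟘 ≈⟨ ≗⇒≈ (λ n → ℤP.+-identityʳ (coeff U n)) ⟩
    ⟦ U ⟧ ∎)))

  HasLeadingTerm-⊛ : ∀ P Y j U → HasLeadingTerm Y j U → HasLeadingTerm (⟦ P ⟧ ⊛ Y) j (mulP P U)
  HasLeadingTerm-⊛ P Y j U (R , Y≈Cʲ[U+CR]) = mulP P R , (begin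
    ⟦ P ⟧ ⊛ Y ≈⟨ *-congˡ ⟦ P ⟧ Y≈Cʲ[U+CR] ⟩
    ⟦ P ⟧ ⊛ (⟦ C ⟧ ^ˢ j ⊛ (⟦ U ⟧ ⊕ ⟦ C ⟧ ⊛ ⟦ R ⟧)) ≈⟨ distribute ⟦ P ⟧ (⟦ C ⟧ ^ˢ j) ⟦ U ⟧ ⟦ C ⟧ ⟦ R ⟧ ⟩
    ⟦ C ⟧ ^ˢ j ⊛ (⟦ P ⟧ ⊛ ⟦ U ⟧ ⊕ ⟦ C ⟧ ⊛ (⟦ P ⟧ ⊛ ⟦ R ⟧))
      ≈⟨ *-congˡ (⟦ C ⟧ ^ˢ j) (⊕-cong (≈-sym (⟦mulP⟧ P U)) (*-congˡ ⟦ C ⟧ (≈-sym (⟦mulP⟧ P R)))) ⟩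
    ⟦ C ⟧ ^ˢ j ⊛ (⟦ mulP P U ⟧ ⊕ ⟦ C ⟧ ⊛ ⟦ mulP P R ⟧) ∎)
    where
    distribute : ∀ p q u c r → p ⊛ (q ⊛ (u ⊕ c ⊛ r)) ≈ q ⊛ (p ⊛ u ⊕ c ⊛ (p ⊛ r))
    distribute = solve 5 (λ p q u c r → p :* (q :* (u :+ c :* r)) := q :* (p :* u :+ c :* (p :* r))) ≈-refl

  HasLeadingTerm-+-higher : ∀ Y t U E → HasLeadingTerm Y t U → HasLeadingTerm (Y ⊕ ⟦ C ⟧ ^ˢ suc t ⊛ ⟦ E ⟧) t U
  HasLeadingTerm-+-higher Y t U E (R , Y≈Cᵗ[U+CR]) = addP R E , (begin
    Y ⊕ ⟦ C ⟧ ^ˢ suc t ⊛ ⟦ E ⟧ ≈⟨ +-congʳ (⟦ C ⟧ ^ˢ suc t ⊛ ⟦ E ⟧) Y≈Cᵗ[U+CR] ⟩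
    ⟦ C ⟧ ^ˢ t ⊛ (⟦ U ⟧ ⊕ ⟦ C ⟧ ⊛ ⟦ R ⟧) ⊕ (⟦ C ⟧ ⊛ ⟦ C ⟧ ^ˢ t) ⊛ ⟦ E ⟧
      ≈⟨ collect (⟦ C ⟧ ^ˢ t) ⟦ U ⟧ ⟦ C ⟧ ⟦ R ⟧ ⟦ E ⟧ ⟩
    ⟦ C ⟧ ^ˢ t ⊛ (⟦ U ⟧ ⊕ ⟦ C ⟧ ⊛ (⟦ R ⟧ ⊕ ⟦ E ⟧))
      ≈⟨ *-congˡ (⟦ C ⟧ ^ˢ t) (+-congˡ ⟦ U ⟧ (*-congˡ ⟦ C ⟧ (≈-sym (⟦addP⟧ R E)))) ⟩
    ⟦ C ⟧ ^ˢ t ⊛ (⟦ U ⟧ ⊕ ⟦ C ⟧ ⊛ ⟦ addP R E ⟧) ∎)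
    where
    collect : ∀ q u c r e → q ⊛ (u ⊕ c ⊛ r) ⊕ (c ⊛ q) ⊛ e ≈ q ⊛ (u ⊕ c ⊛ (r ⊕ e))
    collect = solve 5 (λ q u c r e → q :* (u :+ c :* r) :+ (c :* q) :* e := q :* (u :+ c :* (r :+ e))) ≈-refl

  HasLeadingTerm-deriv : ∀ Y j U → HasLeadingTerm Y (suc j) U →
    HasLeadingTerm (deriv Y) j (mulP (+ suc j ∷ []) (mulP (derivP C) U))
  HasLeadingTerm-deriv Y j U (R , Y≈Cʲ⁺¹[U+CR]) = R′ , (begin
    deriv Y ≈⟨ deriv-cong (≈-trans Y≈Cʲ⁺¹[U+CR] (*-congˡ (⟦ C ⟧ ^ˢ suc j) (≈-sym ⟦E⟧))) ⟩
    deriv (⟦ C ⟧ ^ˢ suc j ⊛ ⟦ E ⟧) ≈⟨ ≗⇒≈ (deriv-⊛ (⟦ C ⟧ ^ˢ suc j) ⟦ E ⟧) ⟩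
    deriv (⟦ C ⟧ ^ˢ suc j) ⊛ ⟦ E ⟧ ⊕ ⟦ C ⟧ ^ˢ suc j ⊛ deriv ⟦ E ⟧
      ≈⟨ ⊕-cong (⊛-cong (≈-trans (deriv-^ˢ ⟦ C ⟧ j) (*-congˡ K (*-congʳ Cʲ (≈-sym ⟦C′⟧)))) ⟦E⟧)
                (*-congˡ (⟦ C ⟧ ^ˢ suc j) (≈-sym (≗⇒≈ (coeff-derivP E)))) ⟩
    (K ⊛ (⟦ C′ ⟧ ⊛ Cʲ)) ⊛ (⟦ U ⟧ ⊕ ⟦ C ⟧ ⊛ ⟦ R ⟧) ⊕ (⟦ C ⟧ ⊛ Cʲ) ⊛ ⟦ derivP E ⟧
      ≈⟨ regroup K ⟦ C′ ⟧ Cʲ ⟦ U ⟧ ⟦ C ⟧ ⟦ R ⟧ ⟦ derivP E ⟧ ⟩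
    Cʲ ⊛ (K ⊛ (⟦ C′ ⟧ ⊛ ⟦ U ⟧) ⊕ ⟦ C ⟧ ⊛ (K ⊛ (⟦ C′ ⟧ ⊛ ⟦ R ⟧) ⊕ ⟦ derivP E ⟧))
      ≈⟨ *-congˡ Cʲ (⊕-cong (≈-sym (⟦K·C′·⟧ U)) (*-congˡ ⟦ C ⟧ (≈-sym ⟦R′⟧))) ⟩
    Cʲ ⊛ (⟦ mulP (+ suc j ∷ []) (mulP C′ U) ⟧ ⊕ ⟦ C ⟧ ⊛ ⟦ R′ ⟧) ∎)
    where
    C′ = derivP C
    K = const (+ suc j)
    Cʲ = ⟦ C ⟧ ^ˢ j
    E = addP U (mulP C R)
    R′ = addP (mulP (+ suc j ∷ []) (mulP C′ R)) (derivP E)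
    ⟦C′⟧ : ⟦ C′ ⟧ ≈ deriv ⟦ C ⟧
    ⟦C′⟧ = ≗⇒≈ (coeff-derivP C)
    ⟦E⟧ : ⟦ E ⟧ ≈ ⟦ U ⟧ ⊕ ⟦ C ⟧ ⊛ ⟦ R ⟧
    ⟦E⟧ = ≈-trans (⟦addP⟧ U (mulP C R)) (+-congˡ ⟦ U ⟧ (⟦mulP⟧ C R))
    ⟦K·C′·⟧ : ∀ X → ⟦ mulP (+ suc j ∷ []) (mulP C′ X) ⟧ ≈ K ⊛ (⟦ C′ ⟧ ⊛ ⟦ X ⟧)
    ⟦K·C′·⟧ X = ≈-trans (⟦mulP⟧ (+ suc j ∷ []) (mulP C′ X)) (*-congˡ K (⟦mulP⟧ C′ X))
    ⟦R′⟧ : ⟦ R′ ⟧ ≈ K ⊛ (⟦ C′ ⟧ ⊛ ⟦ R ⟧) ⊕ ⟦ derivP E ⟧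
    ⟦R′⟧ = ≈-trans (⟦addP⟧ (mulP (+ suc j ∷ []) (mulP C′ R)) (derivP E)) (+-congʳ ⟦ derivP E ⟧ (⟦K·C′·⟧ R))
    regroup : ∀ k c′ q u c r d → (k ⊛ (c′ ⊛ q)) ⊛ (u ⊕ c ⊛ r) ⊕ (c ⊛ q) ⊛ d ≈ q ⊛ (k ⊛ (c′ ⊛ u) ⊕ c ⊛ (k ⊛ (c′ ⊛ r) ⊕ d))
    regroup = solve 7 (λ k c′ q u c r d →
      (k :* (c′ :* q)) :* (u :+ c :* r) :+ (c :* q) :* d := q :* (k :* (c′ :* u) :+ c :* (k :* (c′ :* r) :+ d))) ≈-refl

  HasLeadingTerm-resp-≈ : ∀ {Y Y′} j U → Y ≈ Y′ → HasLeadingTerm Y j U → HasLeadingTerm Y′ j U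
  HasLeadingTerm-resp-≈ j U Y≈Y′ (R , Y≈) = R , ≈-trans (≈-sym Y≈Y′) Y≈

  HasLeadingTerm⇒multiple : ∀ Y i j U → HasLeadingTerm Y (i ℕ.+ j) U → ∃ λ E → Y ≈ ⟦ C ⟧ ^ˢ j ⊛ ⟦ E ⟧
  HasLeadingTerm⇒multiple Y i j U (R , Y≈Cⁱ⁺ʲ[U+CR]) = mulP (powP C i) E , (begin
    Y ≈⟨ Y≈Cⁱ⁺ʲ[U+CR] ⟩
    ⟦ C ⟧ ^ˢ (i ℕ.+ j) ⊛ (⟦ U ⟧ ⊕ ⟦ C ⟧ ⊛ ⟦ R ⟧) ≈⟨ ⊛-cong (^ˢ-+ ⟦ C ⟧ i j) (≈-sym ⟦E⟧) ⟩
    (⟦ C ⟧ ^ˢ i ⊛ ⟦ C ⟧ ^ˢ j) ⊛ ⟦ E ⟧ ≈⟨ swap (⟦ C ⟧ ^ˢ i) (⟦ C ⟧ ^ˢ j) ⟦ E ⟧ ⟩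
    ⟦ C ⟧ ^ˢ j ⊛ (⟦ C ⟧ ^ˢ i ⊛ ⟦ E ⟧)
      ≈⟨ *-congˡ (⟦ C ⟧ ^ˢ j) (≈-sym (≈-trans (⟦mulP⟧ (powP C i) E) (*-congʳ ⟦ E ⟧ (≗⇒≈ (coeff-powP C i))))) ⟩
    ⟦ C ⟧ ^ˢ j ⊛ ⟦ mulP (powP C i) E ⟧ ∎)
    where
    E = addP U (mulP C R)
    ⟦E⟧ : ⟦ E ⟧ ≈ ⟦ U ⟧ ⊕ ⟦ C ⟧ ⊛ ⟦ R ⟧
    ⟦E⟧ = ≈-trans (⟦addP⟧ U (mulP C R)) (+-congˡ ⟦ U ⟧ (⟦mulP⟧ C R))
    swap : ∀ a b e → (a ⊛ b) ⊛ e ≈ b ⊛ (a ⊛ e)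
    swap = solve 3 (λ a b e → (a :* b) :* e := b :* (a :* e)) ≈-refl

  HasLeadingTerm-mulPS-+ : ∀ Q Y ℓ t U Z W → HasLeadingTerm Y (suc (ℓ ℕ.+ t)) U → HasLeadingTerm Z t W →
    HasLeadingTerm (mulPS Q Y ⊕ Z) t W
  HasLeadingTerm-mulPS-+ Q Y ℓ t U Z W leadY leadZ =
    let E , Y≈Cᵗ⁺¹E = HasLeadingTerm⇒multiple Y ℓ (suc t) U (subst (λ e → HasLeadingTerm Y e U) (sym (ℕP.+-suc ℓ t)) leadY)
    in HasLeadingTerm-resp-≈ t W
         (≈-trans (+-congˡ Z (≈-sym (mulPS-multiple E Y≈Cᵗ⁺¹E))) (≗⇒≈ λ n → ℤP.+-comm (Z n) (mulPS Q Y n)))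
         (HasLeadingTerm-+-higher Z t W (mulP Q E) leadZ)
    where
    mulPS-multiple : ∀ E → Y ≈ ⟦ C ⟧ ^ˢ suc t ⊛ ⟦ E ⟧ → mulPS Q Y ≈ ⟦ C ⟧ ^ˢ suc t ⊛ ⟦ mulP Q E ⟧
    mulPS-multiple E Y≈ = begin
      mulPS Q Y ≈⟨ ≗⇒≈ (mulPS-⊛ Q Y) ⟩
      ⟦ Q ⟧ ⊛ Y ≈⟨ *-congˡ ⟦ Q ⟧ Y≈ ⟩
      ⟦ Q ⟧ ⊛ (⟦ C ⟧ ^ˢ suc t ⊛ ⟦ E ⟧) ≈⟨ swap ⟦ Q ⟧ (⟦ C ⟧ ^ˢ suc t) ⟦ E ⟧ ⟩
      ⟦ C ⟧ ^ˢ suc t ⊛ (⟦ Q ⟧ ⊛ ⟦ E ⟧) ≈⟨ *-congˡ (⟦ C ⟧ ^ˢ suc t) (≈-sym (⟦mulP⟧ Q E)) ⟩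
      ⟦ C ⟧ ^ˢ suc t ⊛ ⟦ mulP Q E ⟧ ∎
      where
      swap : ∀ q a e → q ⊛ (a ⊛ e) ≈ a ⊛ (q ⊛ e)
      swap = solve 3 (λ q a e → q :* (a :* e) := a :* (q :* e)) ≈-refl

  module _ {c} (tC : Deg ⟦ C ⟧ c) where

    HasLeadingTerm-𝟘⇒∣ₚ : ∀ Z t W → HasLeadingTerm Z t W → Z ≈ 𝟘 → C ∣ₚ ⟦ W ⟧
    HasLeadingTerm-𝟘⇒∣ₚ Z t W (R , Z≈Cᵗ[W+CR]) Z≈𝟘 = dividesₚ (negP R) (begin
      ⟦ W ⟧ ≈⟨ isolate ⟦ W ⟧ ⟦ C ⟧ ⟦ R ⟧ ⟩
      (⟦ W ⟧ ⊕ ⟦ C ⟧ ⊛ ⟦ R ⟧) ⊕ ⟦ C ⟧ ⊛ ⊝ ⟦ R ⟧ ≈⟨ +-congʳ (⟦ C ⟧ ⊛ ⊝ ⟦ R ⟧) (≈-trans (≈-sym ⟦F⟧) F≈𝟘) ⟩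
      𝟘 ⊕ ⟦ C ⟧ ⊛ ⊝ ⟦ R ⟧ ≈⟨ ≗⇒≈ (λ n → ℤP.+-identityˡ _) ⟩
      ⟦ C ⟧ ⊛ ⊝ ⟦ R ⟧ ≈⟨ *-congˡ ⟦ C ⟧ (≈-sym (≗⇒≈ (coeff-negP R))) ⟩
      ⟦ C ⟧ ⊛ ⟦ negP R ⟧ ∎)
      where
      F = addP W (mulP C R)
      ⟦F⟧ : ⟦ F ⟧ ≈ ⟦ W ⟧ ⊕ ⟦ C ⟧ ⊛ ⟦ R ⟧
      ⟦F⟧ = ≈-trans (⟦addP⟧ W (mulP C R)) (+-congˡ ⟦ W ⟧ (⟦mulP⟧ C R))
      F≈𝟘 : ⟦ F ⟧ ≈ 𝟘
      F≈𝟘 = ⊛-cancel-𝟘 (Deg-^ˢ t tC) F (≈-trans (*-congˡ (⟦ C ⟧ ^ˢ t) ⟦F⟧) (≈-trans (≈-sym Z≈Cᵗ[W+CR]) Z≈𝟘))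
      isolate : ∀ w c r → w ≈ (w ⊕ c ⊛ r) ⊕ c ⊛ ⊝ r
      isolate = solve 3 (λ w c r → w := (w :+ c :* r) :+ c :* (:- r)) ≈-refl

    module _ (irreducible : IrreducibleMod p C) (1≤c : 1 ≤ c) (c<p : c < p) where

      ∤ₚ-scaled-derivP : ∀ k U → ¬ p∣ k → ¬ C ∣ₚ ⟦ U ⟧ → ¬ C ∣ₚ ⟦ mulP (k ∷ []) (mulP (derivP C) U) ⟧
      ∤ₚ-scaled-derivP k U p∤k C∤U = irreducible-∤ₚ-⊛ (k ∷ []) (mulP (derivP C) U) irreducible (∤ₚ-const tC 1≤c p∤k)
        (irreducible-∤ₚ-⊛ (derivP C) U irreducible (∤ₚ-derivP C tC 1≤c c<p) C∤U
          ∘ ∣ₚ-resp-≈ (⟦mulP⟧ (derivP C) U))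
        ∘ ∣ₚ-resp-≈ (⟦mulP⟧ (k ∷ []) (mulP (derivP C) U))

      applyOp-HasLeadingTerm : ∀ L P t Y U → (∀ s → 1 ≤ s → s ≤ length L ℕ.+ t → ¬ p∣ (+ s)) →
        HasLeadingTerm Y (length L ℕ.+ t) U → ¬ C ∣ₚ ⟦ U ⟧ →
        ∃ λ V → ¬ C ∣ₚ ⟦ V ⟧ × HasLeadingTerm (applyOp (L ++ P ∷ []) Y) t (mulP P V)
      applyOp-HasLeadingTerm [] P t Y U _ lead C∤U = U , C∤U ,
        HasLeadingTerm-resp-≈ t (mulP P U) (≗⇒≈ λ n → sym (trans (ℤP.+-identityʳ _) (mulPS-⊛ P Y n)))
          (HasLeadingTerm-⊛ P Y t U lead)
      applyOp-HasLeadingTerm (Q ∷ L) P t Y U p∤ lead C∤U =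
        let j = length L ℕ.+ t
            U′ = mulP (+ suc j ∷ []) (mulP (derivP C) U)
            V , C∤V , lead′ = applyOp-HasLeadingTerm L P t (deriv Y) U′
              (λ s 1≤s s≤j → p∤ s 1≤s (ℕP.m≤n⇒m≤1+n s≤j))
              (HasLeadingTerm-deriv Y j U lead) (∤ₚ-scaled-derivP (+ suc j) U (p∤ (suc j) (s≤s z≤n) ℕP.≤-refl) C∤U)
        in V , C∤V , HasLeadingTerm-mulPS-+ Q Y (length L) t U (applyOp (L ++ P ∷ []) (deriv Y)) (mulP P V) lead lead′

[m∸i]%n≡0⇒m%n≡i : ∀ m n .{{_ : ℕ.NonZero n}} i → i < n → i ≤ m → (m ∸ i) % n ≡ 0 → m % n ≡ i
[m∸i]%n≡0⇒m%n≡i m n i i<n i≤m ≡0 = begin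
  m % n                           ≡⟨ cong (_% n) (sym (ℕP.m∸n+n≡m i≤m)) ⟩
  (m ∸ i ℕ.+ i) % n               ≡⟨ cong (λ t → (t ℕ.+ i) % n) (trans (m≡m%n+[m/n]*n (m ∸ i) n) (cong (ℕ._+ (m ∸ i) / n ℕ.* n) ≡0)) ⟩
  ((m ∸ i) / n ℕ.* n ℕ.+ i) % n   ≡⟨ cong (_% n) (ℕP.+-comm ((m ∸ i) / n ℕ.* n) i) ⟩
  (i ℕ.+ (m ∸ i) / n ℕ.* n) % n   ≡⟨ [m+kn]%n≡m%n i ((m ∸ i) / n) n ⟩
  i % n                           ≡⟨ m<n⇒m%n≡m i<n ⟩
  i                               ∎
  where open ≡-Reasoning

-- The Lucas property factors f as A(x) f(xᵖ) modulo p

module LucasFactorisation {p : ℕ} (prime : Prime p) (f : Series) (f₀≡1 : f 0 ≡ 1ℤ) (lucas : Lucas f) where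

  open ModuloPrime prime
  open import Data.Nat.Primality using (prime⇒nonZero)
  open import Data.Integer.Divisibility.Signed using (∣ᵤ⇒∣)
  import Data.Nat.Divisibility as ℕ∣

  instance
    p≢0 : ℕ.NonZero p
    p≢0 = prime⇒nonZero prime

  A : Poly
  A = truncP f p

  coeff-map-applyUpTo : ∀ g m n → n < m → coeff (map f (applyUpTo g m)) n ≡ f (g n)
  coeff-map-applyUpTo g (suc m) zero _ = refl
  coeff-map-applyUpTo g (suc m) (suc n) (s≤s n<m) = coeff-map-applyUpTo (g ∘ suc) m n n<m

  coeff-map-applyUpTo-≥ : ∀ g m n → m ≤ n → coeff (map f (applyUpTo g m)) n ≡ 0ℤ
  coeff-map-applyUpTo-≥ g zero n _ = refl
  coeff-map-applyUpTo-≥ g (suc m) (suc n) (s≤s m≤n) = coeff-map-applyUpTo-≥ (g ∘ suc) m n m≤n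

  coeff-A-< : ∀ n → n < p → coeff A n ≡ f n
  coeff-A-< = coeff-map-applyUpTo id p

  coeff-A-≥ : ∀ n → p ≤ n → coeff A n ≡ 0ℤ
  coeff-A-≥ = coeff-map-applyUpTo-≥ id p

  keepIfZero : ℕ → ℤ → ℤ
  keepIfZero zero x = x
  keepIfZero (suc _) _ = 0ℤ

  f[xᵖ] : Series
  f[xᵖ] N = keepIfZero (N % p) (f (N / p))

  f[xᵖ]-off : ∀ N → N % p ≢ 0 → f[xᵖ] N ≡ 0ℤ
  f[xᵖ]-off N N%p≢0 with N % p
  ... | zero = ⊥-elim (N%p≢0 refl)
  ... | suc _ = refl

  f[xᵖ]-on : ∀ q → f[xᵖ] (q ℕ.* p) ≡ f q
  f[xᵖ]-on q = cong₂ keepIfZero (m*n%n≡0 q p) (cong f (m*n/n≡m q p))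

  f[xᵖ]₀≡1 : f[xᵖ] 0 ≡ 1ℤ
  f[xᵖ]₀≡1 = trans (f[xᵖ]-on 0) f₀≡1

  deriv-f[xᵖ] : deriv f[xᵖ] ≈ 𝟘
  deriv-f[xᵖ] = p∣⇒≈𝟘 λ n → p∣coefficient (suc n % p ℕP.≟ 0)
    where
    p∣coefficient : ∀ {n} → Dec (suc n % p ≡ 0) → p∣ (+ suc n * f[xᵖ] (suc n))
    p∣coefficient {n} (yes ≡0) = p∣*ʳ {+ suc n} (f[xᵖ] (suc n)) (∣ᵤ⇒∣ (ℕ∣.m%n≡0⇒n∣m (suc n) p ≡0))
    p∣coefficient {n} (no ≢0) = subst p∣_ (sym (trans (cong (+ suc n *_) (f[xᵖ]-off (suc n) ≢0)) (ℤP.*-zeroʳ (+ suc n)))) p∣0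

  -- Only the term i = N mod p survives in the convolution, and there Lucas applies.
  f≈A⊛f[xᵖ] : f ≈ ⟦ A ⟧ ⊛ f[xᵖ]
  f≈A⊛f[xᵖ] = mk≈ λ N → subst (λ t → p∣ (f N - t)) (sym (convolution N)) (lucas′ N)
    where
    lucas′ : ∀ N → p∣ (f N - f (N % p) * f (N / p))
    lucas′ N = subst p∣_ (cong₂ _-_ (cong f (trans (ℕP.+-comm (p ℕ.* (N / p)) (N % p))
                                       (trans (cong (N % p ℕ.+_) (ℕP.*-comm p (N / p))) (sym (m≡m%n+[m/n]*n N p)))))
                                    (ℤP.*-comm (f (N / p)) (f (N % p))))
      (∣ᵤ⇒∣ (lucas p prime (N / p) (N % p) (m%n<n N p)))
    convolution : ∀ N → (⟦ A ⟧ ⊛ f[xᵖ]) N ≡ f (N % p) * f (N / p)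
    convolution N = trans (⊛-sumTo ⟦ A ⟧ f[xᵖ] N) (trans (sumTo-single (suc N) term (N % p) (s≤s (m%n≤m N p)) others) at-residue)
      where
      term : ℕ → ℤ
      term i = coeff A i * f[xᵖ] (N ∸ i)
      others : ∀ i → i < suc N → i ≢ N % p → term i ≡ 0ℤ
      others i i<1+N i≢r with p ℕP.≤? i
      ... | yes p≤i = trans (cong (_* f[xᵖ] (N ∸ i)) (coeff-A-≥ i p≤i)) (ℤP.*-zeroˡ (f[xᵖ] (N ∸ i)))
      ... | no p≰i = trans (cong (coeff A i *_) (f[xᵖ]-off (N ∸ i) (i≢r ∘ sym ∘ [m∸i]%n≡0⇒m%n≡i N p i (ℕP.≰⇒> p≰i) (ℕP.≤-pred i<1+N))))
                           (ℤP.*-zeroʳ (coeff A i))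
      at-residue : term (N % p) ≡ f (N % p) * f (N / p)
      at-residue = cong₂ _*_ (coeff-A-< (N % p) (m%n<n N p))
        (trans (cong f[xᵖ] (trans (cong (_∸ N % p) (m≡m%n+[m/n]*n N p)) (ℕP.m+n∸m≡n (N % p) (N / p ℕ.* p)))) (f[xᵖ]-on (N / p)))

  applyOp-A≈𝟘 : ∀ L → (∀ n → applyOp L f n ≡ 0ℤ) → applyOp L ⟦ A ⟧ ≈ 𝟘
  applyOp-A≈𝟘 L Lf≡0 = ⊛-unit-cancel-𝟘 f[xᵖ]₀≡1 (applyOp L ⟦ A ⟧)
    (≈-trans (≈-sym (applyOp-⊛-constant deriv-f[xᵖ] L f ⟦ A ⟧ f≈A⊛f[xᵖ])) (≗⇒≈ Lf≡0))

  Deg-A : ∃ λ a → Deg ⟦ A ⟧ a × a < p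
  Deg-A = [ (λ A≈𝟘 → ⊥-elim (p∤1 (subst p∣_ (trans (coeff-A-< 0 (ℕP.<-trans (s≤s z≤n) 1<p)) f₀≡1) (≈𝟘⇒p∣ A≈𝟘 0))))
          , (λ { (a , tA) → a , tA , Deg⇒< tA (λ n p≤n → subst p∣_ (sym (coeff-A-≥ n p≤n)) p∣0) }) ]′ (≈𝟘-or-Deg A)

module LeadingCoefficient {p : ℕ} (prime : Prime p) (f : Series) (f₀≡1 : f 0 ≡ 1ℤ) (lucas : Lucas f) where

  open ModuloPrime prime
  open LucasFactorisation prime f f₀≡1 lucas

  ∣ₚ-leading-coefficient : ∀ Ps P → (∀ n → applyOp (Ps ++ P ∷ []) f n ≡ 0ℤ) →
    ∀ C {c} → Deg ⟦ C ⟧ c → IrreducibleMod p C → 1 ≤ c → c < p →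
    ∀ k B → ⟦ A ⟧ ≈ ⟦ C ⟧ ^ˢ k ⊛ ⟦ B ⟧ → ¬ C ∣ₚ ⟦ B ⟧ → k < p → length Ps ≤ k → C ∣ₚ ⟦ P ⟧
  ∣ₚ-leading-coefficient Ps P annihilates C tC irreducible 1≤c c<p k B A≈CᵏB C∤B k<p m≤k =
    let V , C∤V , lead = applyOp-HasLeadingTerm tC irreducible 1≤c c<p Ps P t ⟦ A ⟧ B
          (λ s 1≤s s≤m+t → p∤+ 1≤s (ℕP.≤-<-trans (subst (s ≤_) (sym k≡m+t) s≤m+t) k<p))
          (subst (λ e → HasLeadingTerm ⟦ A ⟧ e B) k≡m+t (factorisation⇒HasLeadingTerm ⟦ A ⟧ k B A≈CᵏB)) C∤B
        C∣PV = HasLeadingTerm-𝟘⇒∣ₚ tC (applyOp (Ps ++ P ∷ []) ⟦ A ⟧) t (mulP P V) lead (applyOp-A≈𝟘 (Ps ++ P ∷ []) annihilates)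
    in irreducible-∣ₚ-⊛ V P irreducible (∣ₚ-resp-≈ (≈-trans (⟦mulP⟧ P V) (≗⇒≈ (⊛-comm ⟦ P ⟧ ⟦ V ⟧))) C∣PV) C∤V
    where
    open CAdic prime C
    t = k ∸ length Ps
    k≡m+t : k ≡ length Ps ℕ.+ t
    k≡m+t = sym (ℕP.m+[n∸m]≡n m≤k)

  irreducible-∣ₚ-A : ∀ Ps P → (∀ n → applyOp (Ps ++ P ∷ []) f n ≡ 0ℤ) →
    ∀ C → IrreducibleMod p C → C ∣ₚ ⟦ A ⟧ → ¬ powP C (length Ps) ∣ₚ ⟦ A ⟧ ⊎ C ∣ₚ ⟦ P ⟧
  irreducible-∣ₚ-A Ps P annihilates C irreducible C∣A =
    let c , tC , 1≤c = irreducible⇒Deg C irreducible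
        a , tA , a<p = Deg-A
        k , B , A≈CᵏB , C∤B , kc≤a = multiplicity C tC 1≤c A tA
        c<p = ℕP.≤-<-trans (∣ₚ⇒Deg≤ C∣A tC tA) a<p
        k<p = ℕP.≤-<-trans (ℕP.≤-trans (subst (_≤ k ℕ.* c) (ℕP.*-identityʳ k) (ℕP.*-monoʳ-≤ k 1≤c)) kc≤a) a<p
        m = length Ps
        Deg-Cᵐ = Deg-resp-≈ (≈-sym (≗⇒≈ (coeff-powP C m))) (Deg-^ˢ m tC)
    in [ (λ Cᵐ∣A → inj₂ (∣ₚ-leading-coefficient Ps P annihilates C tC irreducible 1≤c c<p k B A≈CᵏB C∤B k<p
                           (^ˢ-∣ₚ⇒≤ {C} tC {A} k B A≈CᵏB C∤B m Cᵐ∣A)))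
       , inj₁ ]′ (toSum (∣ₚ? (powP C m) Deg-Cᵐ A))

-- Trailing zero coefficients of a differential operator

open import Data.List.Relation.Unary.Any using (Any; here; there; any?)

¬NonzeroPoly⇒coeff≡0 : ∀ Z → ¬ NonzeroPoly Z → ∀ n → coeff Z n ≡ 0ℤ
¬NonzeroPoly⇒coeff≡0 [] _ n = refl
¬NonzeroPoly⇒coeff≡0 (c ∷ cs) ¬nz zero with c ℤ.≟ 0ℤ
... | yes c≡0 = c≡0
... | no c≢0 = ⊥-elim (¬nz (here c≢0))
¬NonzeroPoly⇒coeff≡0 (c ∷ cs) ¬nz (suc n) = ¬NonzeroPoly⇒coeff≡0 cs (¬nz ∘ there) n

applyOp-zeros : ∀ Zs → ¬ Any NonzeroPoly Zs → ∀ Y → applyOp Zs Y ≗ 𝟘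
applyOp-zeros [] _ Y n = refl
applyOp-zeros (Z ∷ Zs) ¬nz Y n = cong₂ _+_
  (trans (mulPS-⊛ Z Y n) (trans (⊛-congʳ Y (¬NonzeroPoly⇒coeff≡0 Z (¬nz ∘ here)) n) (⊛-zeroˡ Y n)))
  (applyOp-zeros Zs (¬nz ∘ there) (deriv Y) n)

applyOp-drop-zeros : ∀ Ps P Zs → ¬ Any NonzeroPoly Zs → ∀ Y → applyOp (Ps ++ P ∷ Zs) Y ≗ applyOp (Ps ++ P ∷ []) Y
applyOp-drop-zeros [] P Zs ¬nz Y n = cong (_+_ (mulPS P Y n)) (applyOp-zeros Zs ¬nz (deriv Y) n)
applyOp-drop-zeros (Q ∷ Ps) P Zs ¬nz Y n = cong (_+_ (mulPS Q Y n)) (applyOp-drop-zeros Ps P Zs ¬nz (deriv Y) n)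

last-nonzero : ∀ L → Any NonzeroPoly L →
  ∃ λ Ps → ∃ λ P → ∃ λ Zs → L ≡ Ps ++ P ∷ Zs × NonzeroPoly P × ¬ Any NonzeroPoly Zs
last-nonzero (X ∷ Xs) nz with any? (any? (λ c → ¬? (c ℤ.≟ 0ℤ))) Xs
... | yes nz-Xs = let Ps , P , Zs , Xs≡ , nz-P , ¬nz-Zs = last-nonzero Xs nz-Xs in X ∷ Ps , P , Zs , cong (X ∷_) Xs≡ , nz-P , ¬nz-Zs
... | no ¬nz-Xs with nz
...   | here nz-X = [] , X , Xs , refl , nz-X , ¬nz-Xs
...   | there nz-Xs = ⊥-elim (¬nz-Xs nz-Xs)

lemma8p3 : ∀ (a : Series) → InL a →
    ∃ λ (Q : Poly) → ∃ λ (m : ℕ) → NonzeroPoly Q ×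
      (∀ (p : ℕ) → Prime p → ∀ (C : Poly) →
        IrreducibleMod p C → DividesMod p C (truncP a p) →
        (¬ DividesMod p (powP C m) (truncP a p)) ⊎ DividesMod p C Q)
lemma8p3 a (a₀≡1 , lucas , L , nonzero , annihilates) with last-nonzero L nonzero
... | Ps , P , Zs , refl , nonzero-P , zeros = P , length Ps , nonzero-P , λ p prime C irreducible C∣A →
  let open ModuloPrime prime
      annihilates′ n = trans (sym (applyOp-drop-zeros Ps P Zs zeros a n)) (annihilates n)
      A = truncP a p
  in Data.Sum.map (λ Cᵐ∤A → Cᵐ∤A ∘ proj₁ (DividesMod⇔∣ₚ (powP C (length Ps)) A)) (proj₂ (DividesMod⇔∣ₚ C P))
       (LeadingCoefficient.irreducible-∣ₚ-A prime a a₀≡1 lucas Ps P annihilates′ C irreducible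
         (proj₁ (DividesMod⇔∣ₚ C A) C∣A))
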